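{- Fix an integer $m\ge 1$, and let $(T(m,n))_{n\in\mathbb{Z}}$ be the two-sided extrapolated domino-tiling sequence described in the context. Then for every integer $n$, $$T(m,-2-n)=\epsilon_{m,n}\,T(m,n),$$ where $\epsilon_{m,n}=-1$ if $m\equiv 2 \pmod 4$ and $n$ is odd, and $\epsilon_{m,n}=+1$ otherwise.
   Context: For positive integers $m,n$, $T(m,n)$ denotes the number of tilings of an $m$-by-$n$ rectangle by $1$-by-$2$ rectangles (dominos, in either orientation) with pairwise disjoint interiors. For each fixed $m$, the sequence $(T(m,n))_{n\ge1}$ satisfies a linear recurrence relation with constant coefficients. The values $T(m,n)$ for $n\le 0$ are defined by extrapolation: $(T(m,n))_{n\in\mathbb{Z}}$ is the unique two-sided sequence that agrees with the tiling counts for $n\ge1$ and satisfies, for all $n\in\mathbb{Z}$, a linear recurrence with constant coefficients. Concretely, this is the sequence obtained by running such a recurrence backward, and the resulting values do not depend on which recurrence is used. In particular $T(m,0)=1$, and for $m=2$ the extended sequence is the two-sided Fibonacci sequence $\dots,-3,2,-1,1,0,1,1,2,3,\dots$, with $T(2,-1)=0$. -}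

module Defs where

open import Data.Bool using (Bool; true; false; if_then_else_; _∧_)
open import Data.Nat as ℕ using (ℕ; zero; suc; _≡ᵇ_; _%_)
open import Data.List using (List; []; _∷_; _++_; map; concatMap; filter; length; upTo)
open import Data.Bool.ListAction using (and)
open import Data.Integer as ℤ using (ℤ; +_; ∣_∣)
open import Data.Product using (Σ; _×_)
open import Data.List.Relation.Unary.Any using (Any)
open import Relation.Binary.PropositionalEquality using (_≡_; _≢_)
open import Relation.Nullary.Decidable using (does)
open import Data.Bool.Properties using (T?)

-- Cells are unit squares indexed by (row a, column b), a < m, b < n.
-- A domino placement is given by its first cell:
--   hor a b covers the cells (a,b) and (a,b+1);
--   ver a b covers the cells (a,b) and (a+1,b).

data Dom : Set where
  hor : ℕ → ℕ → Dom
  ver : ℕ → ℕ → Dom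

covers : Dom → ℕ → ℕ → Bool
covers (hor i j) a b = (a ≡ᵇ i) ∧ ((b ≡ᵇ j) Data.Bool.∨ (b ≡ᵇ suc j))
covers (ver i j) a b = (b ≡ᵇ j) ∧ ((a ≡ᵇ i) Data.Bool.∨ (a ≡ᵇ suc i))

placements : ℕ → ℕ → List Dom
placements m n =
  concatMap (λ i → map (hor i) (upTo (n ℕ.∸ 1))) (upTo m)
  ++ concatMap (λ i → map (λ j → ver i j) (upTo n)) (upTo (m ℕ.∸ 1))

sublists : {A : Set} → List A → List (List A)
sublists []       = [] ∷ []
sublists (x ∷ xs) = let r = sublists xs in map (x ∷_) r ++ r

coverCount : List Dom → ℕ → ℕ → ℕ
coverCount S a b = length (filter (λ d → T? (covers d a b)) S)

isTiling : ℕ → ℕ → List Dom → Bool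
isTiling m n S = and (concatMap (λ a → map (λ b → coverCount S a b ≡ᵇ 1) (upTo n)) (upTo m))

tilingCount : ℕ → ℕ → ℕ
tilingCount m n = length (filter (λ S → T? (isTiling m n S)) (sublists (placements m n)))

-- Coefficients c₀ … c_d (not all zero) with  Σ_i c_i f(n+i) = 0  for all n ∈ ℤ.
-- (Integer coefficients are no loss of generality for integer-valued sequences.)

recSum : List ℤ → (ℤ → ℤ) → ℤ → ℤ
recSum []       f n = ℤ.0ℤ
recSum (c ∷ cs) f n = c ℤ.* f n ℤ.+ recSum cs f (n ℤ.+ ℤ.1ℤ)

SatisfiesLinRec : (ℤ → ℤ) → Set
SatisfiesLinRec f =
  Σ (List ℤ) λ cs → Any (λ c → c ≢ ℤ.0ℤ) cs × ((n : ℤ) → recSum cs f n ≡ ℤ.0ℤ)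

eps : ℕ → ℤ → ℤ
eps m n = if (m % 4 ≡ᵇ 2) ∧ (∣ n ∣ % 2 ≡ᵇ 1) then ℤ.-1ℤ else ℤ.1ℤ

-- Listing the domino placements column by column, a tiling of the m × n rectangle is built column by
-- column: if H marks the cells of column j covered by horizontal dominoes from column j − 1 and S those
-- covered by horizontal dominoes into column j + 1, the rest of column j must be tiled by vertical dominoes,
-- in A(H, S) ∈ {0, 1} ways. Hence T(m, n) = (e₀ Aⁿ)(∅) for n ≥ 1, with A the symmetric transfer matrix on
-- subsets of the m rows. A is invertible over ℤ: its inverse is σ X Ã X, where Ã(s, t) = A(sᶜ, tᶜ), X is the
-- diagonal matrix of the signs χ, and σ = ±1. The two-sided sequence n ↦ (e₀ Aⁿ)(∅), n ∈ ℤ, satisfies a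
-- linear recurrence (more than 2ᵐ of the vectors e₀ Aʲ are linearly dependent), so it is the extrapolated
-- T(m, ·). Finally complementation exchanges ∅ with the full set and A(full, ·) = e₀, which turns
-- (e₀ A⁻ⁿ⁻²)(∅) into σⁿ (e₀ Aⁿ)(∅); σ = ε(m, 1) is computed from m mod 4.

module Submission where

open import Defs
open import Data.Bool using (Bool)
open import Data.Nat using (ℕ)

module NatProperties where

  open import Data.Bool using (true; false)
  open import Data.Empty using (⊥-elim)
  open import Data.Nat using (zero; suc; _≡ᵇ_)
  open import Relation.Binary.PropositionalEquality using (_≡_; _≢_; refl; cong)

  ≡ᵇ-refl : ∀ n → (n ≡ᵇ n) ≡ true
  ≡ᵇ-refl zero    = refl
  ≡ᵇ-refl (suc n) = ≡ᵇ-refl n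

  ≢⇒≡ᵇ-false : ∀ a b → a ≢ b → (a ≡ᵇ b) ≡ false
  ≢⇒≡ᵇ-false zero    zero    a≢b = ⊥-elim (a≢b refl)
  ≢⇒≡ᵇ-false zero    (suc b) a≢b = refl
  ≢⇒≡ᵇ-false (suc a) zero    a≢b = refl
  ≢⇒≡ᵇ-false (suc a) (suc b) a≢b = ≢⇒≡ᵇ-false a b (λ a≡b → a≢b (cong suc a≡b))

module IntegerProperties where

  open import Data.Empty using (⊥-elim)
  open import Data.Integer using (ℤ; _*_; 0ℤ)
  open import Data.Integer.Properties using (i*j≡0⇒i≡0∨j≡0)
  open import Data.Sum using (inj₁; inj₂)
  open import Relation.Binary.PropositionalEquality using (_≡_; _≢_)

  i*j≡0⇒j≡0 : ∀ {i j} → i ≢ 0ℤ → i * j ≡ 0ℤ → j ≡ 0ℤ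
  i*j≡0⇒j≡0 {i} i≢0 ij≡0 with i*j≡0⇒i≡0∨j≡0 i ij≡0
  ... | inj₁ i≡0 = ⊥-elim (i≢0 i≡0)
  ... | inj₂ j≡0 = j≡0

  i*j≢0 : ∀ {i j} → i ≢ 0ℤ → j ≢ 0ℤ → i * j ≢ 0ℤ
  i*j≢0 i≢0 j≢0 ij≡0 = j≢0 (i*j≡0⇒j≡0 i≢0 ij≡0)

module ListProperties where

  open import Data.Bool using (true; false; if_then_else_; _∧_)
  open import Data.Bool.ListAction using (and)
  open import Data.Bool.Properties using (T?; ∧-assoc; ∧-identityʳ; ∧-commutativeMonoid)
  open import Algebra.Bundles using (CommutativeMonoid)
  open import Algebra.Properties.CommutativeSemigroup (CommutativeMonoid.commutativeSemigroup ∧-commutativeMonoid)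
    renaming (interchange to ∧-interchange)
  open import Data.List using (List; []; _∷_; _++_; [_]; map; concat; concatMap; filter; length; upTo; applyUpTo)
  open import Data.List.Properties using (map-++; upTo-∷ʳ; concatMap-cong; ++-assoc)
  open import Data.List.Relation.Binary.Permutation.Propositional as ↭ using (_↭_; ↭-refl; ↭-trans; ↭-reflexive)
  open import Data.List.Relation.Binary.Permutation.Propositional.Properties using (++⁺ˡ; ++⁺ʳ; ++-comm; shifts)
  open import Data.Nat using (zero; suc; _+_; _<_; s≤s; z≤n)
  open import Relation.Binary.PropositionalEquality using (_≡_; refl; sym; trans; cong; cong₂; module ≡-Reasoning)

  count : {A : Set} → (A → Bool) → List A → ℕ
  count p []       = 0
  count p (x ∷ xs) = if p x then suc (count p xs) else count p xs

  length-filter≡count : {A : Set} (p : A → Bool) (xs : List A) →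
    length (filter (λ x → T? (p x)) xs) ≡ count p xs
  length-filter≡count p []       = refl
  length-filter≡count p (x ∷ xs) with p x
  ... | true  = cong suc (length-filter≡count p xs)
  ... | false = length-filter≡count p xs

  count-++ : {A : Set} (p : A → Bool) (xs ys : List A) → count p (xs ++ ys) ≡ count p xs + count p ys
  count-++ p []       ys = refl
  count-++ p (x ∷ xs) ys with p x
  ... | true  = cong suc (count-++ p xs ys)
  ... | false = count-++ p xs ys

  count-map : {A B : Set} (p : B → Bool) (g : A → B) (xs : List A) →
    count p (map g xs) ≡ count (λ x → p (g x)) xs
  count-map p g []       = refl
  count-map p g (x ∷ xs) with p (g x)
  ... | true  = cong suc (count-map p g xs)
  ... | false = count-map p g xs

  count-cong : {A : Set} {p q : A → Bool} → (∀ x → p x ≡ q x) → (xs : List A) → count p xs ≡ count q xs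
  count-cong         p≗q []       = refl
  count-cong {q = q} p≗q (x ∷ xs) rewrite p≗q x with q x
  ... | true  = cong suc (count-cong p≗q xs)
  ... | false = count-cong p≗q xs

  concatMap-nil : {A B : Set} (xs : List B) → concatMap {B = A} (λ _ → []) xs ≡ []
  concatMap-nil []       = refl
  concatMap-nil (x ∷ xs) = concatMap-nil xs

  concatMap-∷ʳ↭ : {A B : Set} (P : B → List A) (q : B → A) (xs : List B) →
    concatMap (λ i → P i ++ [ q i ]) xs ↭ map q xs ++ concatMap P xs
  concatMap-∷ʳ↭ P q []       = ↭-refl
  concatMap-∷ʳ↭ P q (x ∷ xs) =
    ↭-trans (++⁺ʳ (concatMap (λ i → P i ++ [ q i ]) xs) (++-comm (P x) [ q x ]))
            (↭.prep (q x) (↭-trans (++⁺ˡ (P x) (concatMap-∷ʳ↭ P q xs)) (shifts (P x) (map q xs))))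

  concatMap-upTo-suc↭ : {A : Set} (f : ℕ → ℕ → A) (c : ℕ) (rows : List ℕ) →
    concatMap (λ i → map (f i) (upTo (suc c))) rows
      ↭ map (λ i → f i c) rows ++ concatMap (λ i → map (f i) (upTo c)) rows
  concatMap-upTo-suc↭ f c rows =
    ↭-trans (↭-reflexive (concatMap-cong lastColumn rows))
            (concatMap-∷ʳ↭ (λ i → map (f i) (upTo c)) (λ i → f i c) rows)
    where
    lastColumn : ∀ i → map (f i) (upTo (suc c)) ≡ map (f i) (upTo c) ++ [ f i c ]
    lastColumn i = trans (cong (map (f i)) (sym (upTo-∷ʳ c))) (map-++ (f i) (upTo c) [ c ])

  ++-interchange↭ : {A : Set} (as bs cs ds : List A) → (as ++ bs) ++ (cs ++ ds) ↭ as ++ cs ++ bs ++ ds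
  ++-interchange↭ as bs cs ds =
    ↭-trans (↭-reflexive (++-assoc as bs (cs ++ ds))) (++⁺ˡ as (shifts bs cs))

  and-++ : ∀ xs ys → and (xs ++ ys) ≡ and xs ∧ and ys
  and-++ []       ys = refl
  and-++ (x ∷ xs) ys = trans (cong (x ∧_) (and-++ xs ys)) (sym (∧-assoc x (and xs) (and ys)))

  applyUpTo-cong-< : {B : Set} → ∀ n {f g : ℕ → B} → (∀ i → i < n → f i ≡ g i) → applyUpTo f n ≡ applyUpTo g n
  applyUpTo-cong-< zero    f≗g = refl
  applyUpTo-cong-< (suc n) f≗g = cong₂ _∷_ (f≗g 0 (s≤s z≤n)) (applyUpTo-cong-< n (λ i i<n → f≗g (suc i) (s≤s i<n)))

  and-concat-∷ʳ : ∀ m (X : ℕ → List Bool) (y : ℕ → Bool) →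
    and (concat (applyUpTo (λ a → X a ++ [ y a ]) m)) ≡ and (concat (applyUpTo X m)) ∧ and (applyUpTo y m)
  and-concat-∷ʳ zero    X y = refl
  and-concat-∷ʳ (suc m) X y = begin
      and ((X 0 ++ [ y 0 ]) ++ concat (applyUpTo (λ a → X (suc a) ++ [ y (suc a) ]) m))
    ≡⟨ and-++ (X 0 ++ [ y 0 ]) _ ⟩
      and (X 0 ++ [ y 0 ]) ∧ and (concat (applyUpTo (λ a → X (suc a) ++ [ y (suc a) ]) m))
    ≡⟨ cong₂ _∧_ (trans (and-++ (X 0) [ y 0 ]) (cong (and (X 0) ∧_) (∧-identityʳ (y 0))))
                 (and-concat-∷ʳ m (λ a → X (suc a)) (λ a → y (suc a))) ⟩
      (and (X 0) ∧ y 0) ∧ (and (concat (applyUpTo (λ a → X (suc a)) m)) ∧ and (applyUpTo (λ a → y (suc a)) m))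
    ≡⟨ ∧-interchange (and (X 0)) (y 0) _ _ ⟩
      (and (X 0) ∧ and (concat (applyUpTo (λ a → X (suc a)) m))) ∧ (y 0 ∧ and (applyUpTo (λ a → y (suc a)) m))
    ≡⟨ cong (_∧ (y 0 ∧ and (applyUpTo (λ a → y (suc a)) m))) (and-++ (X 0) _) ⟨
      and (X 0 ++ concat (applyUpTo (λ a → X (suc a)) m)) ∧ (y 0 ∧ and (applyUpTo (λ a → y (suc a)) m))
    ∎
    where open ≡-Reasoning

module Completions where

  open ListProperties
  open import Data.Bool using (true; false; if_then_else_)
  open import Data.Bool.ListAction using (and)
  open import Data.List using (List; []; _∷_; _++_; map; concat; concatMap; upTo)
  open import Data.List.Properties using (map-cong)
  open import Data.Nat using (_+_; _≡ᵇ_)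
  open import Data.Nat.Properties using (+-assoc; +-identityʳ)
  open import Relation.Binary.PropositionalEquality using (_≡_; refl; sym; trans; cong; cong₂; module ≡-Reasoning)

  Coverage : Set
  Coverage = ℕ → ℕ → ℕ

  coverage : Dom → Coverage
  coverage d a b = if covers d a b then 1 else 0

  _⊕_ : Coverage → Dom → Coverage
  (k ⊕ d) a b = k a b + coverage d a b

  isExactCover : ℕ → ℕ → Coverage → Bool
  isExactCover m n k = and (concatMap (λ a → map (λ b → k a b ≡ᵇ 1) (upTo n)) (upTo m))

  completions : ℕ → ℕ → List Dom → Coverage → ℕ
  completions m n []      k = if isExactCover m n k then 1 else 0
  completions m n (d ∷ L) k = completions m n L (k ⊕ d) + completions m n L k

  isExactCover-cong : ∀ m n {k k′ : Coverage} → (∀ a b → k a b ≡ k′ a b) →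
    isExactCover m n k ≡ isExactCover m n k′
  isExactCover-cong m n k≗k′ =
    cong (λ rows → and (concat rows))
      (map-cong (λ a → map-cong (λ b → cong (_≡ᵇ 1) (k≗k′ a b)) (upTo n)) (upTo m))

  completions-cong : ∀ m n L {k k′ : Coverage} → (∀ a b → k a b ≡ k′ a b) →
    completions m n L k ≡ completions m n L k′
  completions-cong m n []      k≗k′ = cong (λ b → if b then 1 else 0) (isExactCover-cong m n k≗k′)
  completions-cong m n (d ∷ L) k≗k′ =
    cong₂ _+_ (completions-cong m n L (λ a b → cong (_+ coverage d a b) (k≗k′ a b)))
              (completions-cong m n L k≗k′)

  coverCount-∷ : ∀ d S a b → coverCount (d ∷ S) a b ≡ coverage d a b + coverCount S a b
  coverCount-∷ d S a b with covers d a b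
  ... | true  = refl
  ... | false = refl

  count-sublists≡completions : ∀ m n L (k : Coverage) →
    count (λ S → isExactCover m n (λ a b → k a b + coverCount S a b)) (sublists L) ≡ completions m n L k
  count-sublists≡completions m n [] k =
    cong (λ b → if b then 1 else 0) (isExactCover-cong m n (λ a b → +-identityʳ (k a b)))
  count-sublists≡completions m n (d ∷ L) k = begin
      count exact (map (d ∷_) (sublists L) ++ sublists L)
    ≡⟨ count-++ exact (map (d ∷_) (sublists L)) (sublists L) ⟩
      count exact (map (d ∷_) (sublists L)) + count exact (sublists L)
    ≡⟨ cong (_+ count exact (sublists L)) (count-map exact (d ∷_) (sublists L)) ⟩
      count (λ S → exact (d ∷ S)) (sublists L) + count exact (sublists L)
    ≡⟨ cong (_+ count exact (sublists L)) (count-cong addFirst (sublists L)) ⟩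
      count (λ S → isExactCover m n (λ a b → (k ⊕ d) a b + coverCount S a b)) (sublists L)
        + count exact (sublists L)
    ≡⟨ cong₂ _+_ (count-sublists≡completions m n L (k ⊕ d)) (count-sublists≡completions m n L k) ⟩
      completions m n (d ∷ L) k
    ∎
    where
    open ≡-Reasoning
    exact : List Dom → Bool
    exact S = isExactCover m n (λ a b → k a b + coverCount S a b)
    addFirst : ∀ S → exact (d ∷ S) ≡ isExactCover m n (λ a b → (k ⊕ d) a b + coverCount S a b)
    addFirst S = isExactCover-cong m n (λ a b →
      trans (cong (k a b +_) (coverCount-∷ d S a b)) (sym (+-assoc (k a b) _ _)))

  tilingCount≡completions : ∀ m n → tilingCount m n ≡ completions m n (placements m n) (λ _ _ → 0)
  tilingCount≡completions m n =
    trans (length-filter≡count _ (sublists (placements m n)))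
          (count-sublists≡completions m n (placements m n) (λ _ _ → 0))

module ColumnOrder where

  open ListProperties
  open Completions
  open import Data.List using (List; []; _∷_; _++_; map; concatMap; upTo)
  open import Data.List.Relation.Binary.Permutation.Propositional as ↭
    using (_↭_; ↭-refl; ↭-trans; ↭-reflexive; module PermutationReasoning)
  open import Data.List.Relation.Binary.Permutation.Propositional.Properties using (++⁺; ++⁺ˡ)
  open import Data.Nat using (zero; suc; _+_; _∸_)
  open import Data.Nat.Properties using (+-commutativeSemigroup)
  open import Algebra.Properties.CommutativeSemigroup +-commutativeSemigroup using (interchange; xy∙z≈xz∙y)
  open import Relation.Binary.PropositionalEquality using (_≡_; refl; trans; cong; cong₂)

  completions-swap : ∀ m n d e L k → completions m n (d ∷ e ∷ L) k ≡ completions m n (e ∷ d ∷ L) k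
  completions-swap m n d e L k =
    trans (cong (λ x → x + C (k ⊕ d) + (C (k ⊕ e) + C k))
                (completions-cong m n L (λ a b → xy∙z≈xz∙y (k a b) (coverage d a b) (coverage e a b))))
          (interchange (C ((k ⊕ e) ⊕ d)) (C (k ⊕ d)) (C (k ⊕ e)) (C k))
    where
    C : Coverage → ℕ
    C = completions m n L

  completions-↭ : ∀ m n {L L′} → L ↭ L′ → ∀ k → completions m n L k ≡ completions m n L′ k
  completions-↭ m n ↭.refl                k = refl
  completions-↭ m n (↭.prep d L↭L′)      k = cong₂ _+_ (completions-↭ m n L↭L′ _) (completions-↭ m n L↭L′ k)
  completions-↭ m n {d ∷ e ∷ L} (↭.swap d e L↭L′) k =
    trans (completions-swap m n d e L k)
          (cong₂ _+_ (cong₂ _+_ (completions-↭ m n L↭L′ _) (completions-↭ m n L↭L′ _))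
                     (cong₂ _+_ (completions-↭ m n L↭L′ _) (completions-↭ m n L↭L′ k)))
  completions-↭ m n (↭.trans L↭L′ L′↭L″) k = trans (completions-↭ m n L↭L′ k) (completions-↭ m n L′↭L″ k)

  horizontals : ℕ → ℕ → List Dom
  horizontals m c = concatMap (λ i → map (hor i) (upTo c)) (upTo m)

  verticals : ℕ → ℕ → List Dom
  verticals m n = concatMap (λ i → map (ver i) (upTo n)) (upTo (m ∸ 1))

  horizontalsInto : ℕ → ℕ → List Dom
  horizontalsInto m zero    = []
  horizontalsInto m (suc j) = map (λ i → hor i j) (upTo m)

  verticalsAt : ℕ → ℕ → List Dom
  verticalsAt m n = map (λ i → ver i n) (upTo (m ∸ 1))

  columnwise : ℕ → ℕ → List Dom
  columnwise m zero    = []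
  columnwise m (suc n) = horizontalsInto m n ++ verticalsAt m n ++ columnwise m n

  horizontals↭ : ∀ m n → horizontals m n ↭ horizontalsInto m n ++ horizontals m (n ∸ 1)
  horizontals↭ m zero    = ↭-refl
  horizontals↭ m (suc j) = concatMap-upTo-suc↭ hor j (upTo m)

  placements↭columnwise : ∀ m n → placements m n ↭ columnwise m n
  placements↭columnwise m zero =
    ↭-reflexive (cong₂ _++_ (concatMap-nil (upTo m)) (concatMap-nil (upTo (m ∸ 1))))
  placements↭columnwise m (suc n) = begin
      horizontals m n ++ verticals m (suc n)
    ↭⟨ ++⁺ (horizontals↭ m n) (concatMap-upTo-suc↭ ver n (upTo (m ∸ 1))) ⟩
      (horizontalsInto m n ++ horizontals m (n ∸ 1)) ++ (verticalsAt m n ++ verticals m n)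
    ↭⟨ ++-interchange↭ (horizontalsInto m n) _ (verticalsAt m n) _ ⟩
      horizontalsInto m n ++ verticalsAt m n ++ horizontals m (n ∸ 1) ++ verticals m n
    ↭⟨ ++⁺ˡ (horizontalsInto m n) (++⁺ˡ (verticalsAt m n) (placements↭columnwise m n)) ⟩
      columnwise m (suc n)
    ∎
    where open PermutationReasoning

module ColumnDecomposition where

  open ListProperties
  open Completions
  open import Data.Bool using (true; false; if_then_else_; _∧_)
  open import Data.Bool.ListAction using (and)
  open import Data.List using ([]; _∷_; _++_; [_]; map; concat; upTo; applyUpTo)
  open import Data.List.Properties using (map-upTo; applyUpTo-∷ʳ)
  open import Data.List.Relation.Unary.All using (All; []; _∷_)
  open import Data.Nat using (zero; suc; _+_; _*_; _≡ᵇ_; _<_)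
  open import Data.Nat.Properties using (+-assoc; +-identityʳ; *-distribˡ-+)
  open import Data.Vec using (Vec; []; _∷_)
  open import Relation.Binary.PropositionalEquality using (_≡_; refl; sym; trans; cong; cong₂; module ≡-Reasoning)

  sumℕ : (l : ℕ) → (Vec Bool l → ℕ) → ℕ
  sumℕ zero    g = g []
  sumℕ (suc l) g = sumℕ l (λ v → g (true ∷ v)) + sumℕ l (λ v → g (false ∷ v))

  sumℕ-cong : ∀ l {g h : Vec Bool l → ℕ} → (∀ v → g v ≡ h v) → sumℕ l g ≡ sumℕ l h
  sumℕ-cong zero    g≗h = g≗h []
  sumℕ-cong (suc l) g≗h = cong₂ _+_ (sumℕ-cong l (λ v → g≗h (true ∷ v))) (sumℕ-cong l (λ v → g≗h (false ∷ v)))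

  sumℕ-*ˡ : ∀ l (c : ℕ) (g : Vec Bool l → ℕ) → sumℕ l (λ v → c * g v) ≡ c * sumℕ l g
  sumℕ-*ˡ zero    c g = refl
  sumℕ-*ˡ (suc l) c g = trans (cong₂ _+_ (sumℕ-*ˡ l c _) (sumℕ-*ˡ l c _)) (sym (*-distribˡ-+ c _ _))

  sumℕ-zero : ∀ l {g : Vec Bool l → ℕ} → (∀ v → g v ≡ 0) → sumℕ l g ≡ 0
  sumℕ-zero zero    g≗0 = g≗0 []
  sumℕ-zero (suc l) g≗0 = cong₂ _+_ (sumℕ-zero l (λ v → g≗0 (true ∷ v))) (sumℕ-zero l (λ v → g≗0 (false ∷ v)))

  selectedCoverage : {l : ℕ} → (ℕ → Dom) → Vec Bool l → Coverage
  selectedCoverage f []       a b = 0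
  selectedCoverage f (c ∷ cs) a b =
    (if c then coverage (f 0) a b else 0) + selectedCoverage (λ i → f (suc i)) cs a b

  completions-applyUpTo : ∀ m n l (f : ℕ → Dom) L k →
    completions m n (applyUpTo f l ++ L) k
      ≡ sumℕ l (λ cs → completions m n L (λ a b → k a b + selectedCoverage f cs a b))
  completions-applyUpTo m n zero    f L k = completions-cong m n L (λ a b → sym (+-identityʳ (k a b)))
  completions-applyUpTo m n (suc l) f L k = cong₂ _+_
    (trans (completions-applyUpTo m n l (λ i → f (suc i)) L (k ⊕ f 0))
           (sumℕ-cong l (λ cs → completions-cong m n L (λ a b → +-assoc (k a b) _ _))))
    (completions-applyUpTo m n l (λ i → f (suc i)) L k)

  isExactCover-applyUpTo : ∀ m n k →
    isExactCover m n k ≡ and (concat (applyUpTo (λ a → applyUpTo (λ b → k a b ≡ᵇ 1) n) m))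
  isExactCover-applyUpTo m n k = cong (λ rows → and (concat rows))
    (trans (map-upTo (λ a → map (λ b → k a b ≡ᵇ 1) (upTo n)) m)
           (applyUpTo-cong-< m (λ a _ → map-upTo (λ b → k a b ≡ᵇ 1) n)))

  isExactCover-local : ∀ m n {k k′ : Coverage} → (∀ a b → a < m → b < n → k a b ≡ k′ a b) →
    isExactCover m n k ≡ isExactCover m n k′
  isExactCover-local m n {k} {k′} k≗k′ = begin
      isExactCover m n k
    ≡⟨ isExactCover-applyUpTo m n k ⟩
      and (concat (applyUpTo (λ a → applyUpTo (λ b → k a b ≡ᵇ 1) n) m))
    ≡⟨ cong (λ rows → and (concat rows)) (applyUpTo-cong-< m (λ a a<m →
         applyUpTo-cong-< n (λ b b<n → cong (_≡ᵇ 1) (k≗k′ a b a<m b<n)))) ⟩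
      and (concat (applyUpTo (λ a → applyUpTo (λ b → k′ a b ≡ᵇ 1) n) m))
    ≡⟨ isExactCover-applyUpTo m n k′ ⟨
      isExactCover m n k′
    ∎
    where open ≡-Reasoning

  completions-local : ∀ m n L {k k′ : Coverage} → (∀ a b → a < m → b < n → k a b ≡ k′ a b) →
    completions m n L k ≡ completions m n L k′
  completions-local m n []      k≗k′ = cong (λ b → if b then 1 else 0) (isExactCover-local m n k≗k′)
  completions-local m n (d ∷ L) k≗k′ =
    cong₂ _+_ (completions-local m n L (λ a b a<m b<n → cong (_+ coverage d a b) (k≗k′ a b a<m b<n)))
              (completions-local m n L k≗k′)

  isExactColumn : ℕ → ℕ → Coverage → Bool
  isExactColumn m n k = and (applyUpTo (λ a → k a n ≡ᵇ 1) m)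

  isExactCover-suc : ∀ m n k → isExactCover m (suc n) k ≡ isExactCover m n k ∧ isExactColumn m n k
  isExactCover-suc m n k = begin
      isExactCover m (suc n) k
    ≡⟨ isExactCover-applyUpTo m (suc n) k ⟩
      and (concat (applyUpTo (λ a → applyUpTo (λ b → k a b ≡ᵇ 1) (suc n)) m))
    ≡⟨ cong (λ rows → and (concat rows)) (applyUpTo-cong-< m (λ a _ → applyUpTo-∷ʳ (λ b → k a b ≡ᵇ 1) n)) ⟨
      and (concat (applyUpTo (λ a → applyUpTo (λ b → k a b ≡ᵇ 1) n ++ [ k a n ≡ᵇ 1 ]) m))
    ≡⟨ and-concat-∷ʳ m (λ a → applyUpTo (λ b → k a b ≡ᵇ 1) n) (λ a → k a n ≡ᵇ 1) ⟩
      and (concat (applyUpTo (λ a → applyUpTo (λ b → k a b ≡ᵇ 1) n) m)) ∧ isExactColumn m n k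
    ≡⟨ cong (_∧ isExactColumn m n k) (isExactCover-applyUpTo m n k) ⟨
      isExactCover m n k ∧ isExactColumn m n k
    ∎
    where open ≡-Reasoning

  Avoids : ℕ → Dom → Set
  Avoids b d = ∀ a → covers d a b ≡ false

  completions-suc : ∀ m n L k → All (Avoids n) L →
    completions m (suc n) L k ≡ (if isExactColumn m n k then completions m n L k else 0)
  completions-suc m n [] k [] =
    trans (cong (λ b → if b then 1 else 0) (isExactCover-suc m n k)) (if-∧ (isExactCover m n k) (isExactColumn m n k))
    where
    if-∧ : ∀ b c → (if b ∧ c then 1 else 0) ≡ (if c then (if b then 1 else 0) else 0)
    if-∧ true  c     = refl
    if-∧ false true  = refl
    if-∧ false false = refl
  completions-suc m n (d ∷ L) k (d-avoids ∷ L-avoids) =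
    trans (cong₂ _+_ (completions-suc m n L (k ⊕ d) L-avoids) (completions-suc m n L k L-avoids))
          (trans (cong (λ c → (if c then completions m n L (k ⊕ d) else 0)
                                + (if isExactColumn m n k then completions m n L k else 0)) sameColumn)
                 (if-+ (isExactColumn m n k)))
    where
    sameColumn : isExactColumn m n (k ⊕ d) ≡ isExactColumn m n k
    sameColumn = cong and (applyUpTo-cong-< m (λ a _ → cong (_≡ᵇ 1)
      (trans (cong (λ c → k a n + (if c then 1 else 0)) (d-avoids a)) (+-identityʳ (k a n)))))
    if-+ : ∀ {x y} c → (if c then x else 0) + (if c then y else 0) ≡ (if c then x + y else 0)
    if-+ true  = refl
    if-+ false = refl

module TransferMatrix where

  open NatProperties
  open ListProperties
  open Completions
  open ColumnOrder
  open ColumnDecomposition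
  open import Data.Bool using (true; false; if_then_else_; _∧_; _∨_)
  open import Data.Bool.ListAction using (and)
  open import Data.Bool.Properties using (∧-zeroʳ)
  open import Data.List using ([]; _∷_; _++_; upTo; applyUpTo)
  open import Data.List.Properties using (map-upTo)
  open import Data.List.Relation.Unary.All using (All; []; _∷_; universal)
  open import Data.List.Relation.Unary.All.Properties using (++⁺; map⁺)
  open import Data.Nat using (zero; suc; _+_; _*_; _∸_; _≡ᵇ_; _<_; _≤_)
  open import Data.Nat.Properties using (+-assoc; +-comm; +-identityʳ; *-zeroʳ; *-identityʳ; <⇒≢; >⇒≢; ≤-trans; n≤1+n; ≤-refl; n<1+n)
  open import Data.Vec using (Vec; []; _∷_; replicate)
  open import Relation.Binary.PropositionalEquality using (_≡_; refl; sym; trans; cong; cong₂; module ≡-Reasoning)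

  -- transfer p s t counts the ways to tile a column by vertical dominoes avoiding the cells marked
  -- in s and in t; p says that the cell above is the upper half of a vertical domino still to be closed.
  transfer : {l : ℕ} → Bool → Vec Bool l → Vec Bool l → ℕ
  transfer false []          []          = 1
  transfer true  []          []          = 0
  transfer false (true ∷ s)  (true ∷ t)  = 0
  transfer false (true ∷ s)  (false ∷ t) = transfer false s t
  transfer false (false ∷ s) (true ∷ t)  = transfer false s t
  transfer false (false ∷ s) (false ∷ t) = transfer true s t
  transfer true  (false ∷ s) (false ∷ t) = transfer false s t
  transfer true  (true ∷ s)  t           = 0
  transfer true  (false ∷ s) (true ∷ t)  = 0

  bit : Bool → ℕ
  bit b = if b then 1 else 0

  cell : {l : ℕ} → Vec Bool l → ℕ → ℕ
  cell []      a       = 0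
  cell (s ∷ S) zero    = bit s
  cell (s ∷ S) (suc a) = cell S a

  -- V i marks a vertical domino on the rows i and i + 1.
  verticalCoverage : {l : ℕ} → Vec Bool l → ℕ → ℕ
  verticalCoverage []      a             = 0
  verticalCoverage (v ∷ V) zero          = bit v
  verticalCoverage (v ∷ V) (suc zero)    = bit v + verticalCoverage V zero
  verticalCoverage (v ∷ V) (suc (suc a)) = verticalCoverage V (suc a)

  pendingCoverage : Bool → ℕ → ℕ
  pendingCoverage true zero = 1
  pendingCoverage _    _    = 0

  fillsColumn : {l : ℕ} → Bool → Vec Bool (suc l) → Vec Bool (suc l) → Vec Bool l → Bool
  fillsColumn {l} p H S V =
    and (applyUpTo (λ a → (pendingCoverage p a + cell S a + cell H a + verticalCoverage V a) ≡ᵇ 1) (suc l))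

  sumℕ-if : ∀ l (b : Vec Bool l → Bool) (c : ℕ) → sumℕ l (λ v → if b v then c else 0) ≡ c * sumℕ l (λ v → bit (b v))
  sumℕ-if l b c = trans (sumℕ-cong l (λ v → if≡*bit (b v))) (sumℕ-*ˡ l c _)
    where
    if≡*bit : ∀ x → (if x then c else 0) ≡ c * bit x
    if≡*bit true  = sym (*-identityʳ c)
    if≡*bit false = sym (*-zeroʳ c)

  verticalCoverage-∷ : ∀ {l} v (V : Vec Bool l) a → verticalCoverage (v ∷ V) (suc a) ≡ pendingCoverage v a + verticalCoverage V a
  verticalCoverage-∷ true  V zero    = refl
  verticalCoverage-∷ false V zero    = refl
  verticalCoverage-∷ true  V (suc a) = refl
  verticalCoverage-∷ false V (suc a) = refl

  fillsColumn-∷ : ∀ l p (h s : Bool) (H S : Vec Bool (suc l)) v (V : Vec Bool l) →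
    and (applyUpTo (λ a → (pendingCoverage p (suc a) + cell (s ∷ S) (suc a) + cell (h ∷ H) (suc a)
                            + verticalCoverage (v ∷ V) (suc a)) ≡ᵇ 1) (suc l))
      ≡ fillsColumn v H S V
  fillsColumn-∷ l p h s H S v V = cong and (applyUpTo-cong-< (suc l) (λ a _ → cong (_≡ᵇ 1) (shifted a)))
    where
    pendingCoverage-suc : ∀ p a → pendingCoverage p (suc a) ≡ 0
    pendingCoverage-suc false a = refl
    pendingCoverage-suc true  a = refl
    rearrange : ∀ x y z w → y + z + (x + w) ≡ x + y + z + w
    rearrange x y z w = trans (sym (+-assoc (y + z) x w)) (cong (_+ w) (trans (+-comm (y + z) x) (sym (+-assoc x y z))))
    shifted : ∀ a → pendingCoverage p (suc a) + cell S a + cell H a + verticalCoverage (v ∷ V) (suc a)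
                  ≡ pendingCoverage v a + cell S a + cell H a + verticalCoverage V a
    shifted a rewrite pendingCoverage-suc p a | verticalCoverage-∷ v V a =
      rearrange (pendingCoverage v a) (cell S a) (cell H a) (verticalCoverage V a)

  sumℕ-fillsColumn≡transfer : ∀ l (p : Bool) (H S : Vec Bool (suc l)) →
    sumℕ l (λ V → bit (fillsColumn p H S V)) ≡ transfer p H S
  sumℕ-fillsColumn≡transfer zero false (true ∷ [])  (true ∷ [])  = refl
  sumℕ-fillsColumn≡transfer zero false (true ∷ [])  (false ∷ []) = refl
  sumℕ-fillsColumn≡transfer zero false (false ∷ []) (true ∷ [])  = refl
  sumℕ-fillsColumn≡transfer zero false (false ∷ []) (false ∷ []) = refl
  sumℕ-fillsColumn≡transfer zero true  (true ∷ [])  (true ∷ [])  = refl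
  sumℕ-fillsColumn≡transfer zero true  (true ∷ [])  (false ∷ []) = refl
  sumℕ-fillsColumn≡transfer zero true  (false ∷ []) (true ∷ [])  = refl
  sumℕ-fillsColumn≡transfer zero true  (false ∷ []) (false ∷ []) = refl
  sumℕ-fillsColumn≡transfer (suc l) false (true ∷ H) (true ∷ S) =
    cong₂ _+_ (sumℕ-zero l (λ V → refl)) (sumℕ-zero l (λ V → refl))
  sumℕ-fillsColumn≡transfer (suc l) false (true ∷ H) (false ∷ S) = cong₂ _+_ (sumℕ-zero l (λ V → refl))
    (trans (sumℕ-cong l (λ V → cong bit (fillsColumn-∷ l false true false H S false V))) (sumℕ-fillsColumn≡transfer l false H S))
  sumℕ-fillsColumn≡transfer (suc l) false (false ∷ H) (true ∷ S) = cong₂ _+_ (sumℕ-zero l (λ V → refl))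
    (trans (sumℕ-cong l (λ V → cong bit (fillsColumn-∷ l false false true H S false V))) (sumℕ-fillsColumn≡transfer l false H S))
  sumℕ-fillsColumn≡transfer (suc l) false (false ∷ H) (false ∷ S) = trans (cong₂ _+_
    (trans (sumℕ-cong l (λ V → cong bit (fillsColumn-∷ l false false false H S true V))) (sumℕ-fillsColumn≡transfer l true H S))
    (sumℕ-zero l (λ V → refl))) (+-identityʳ _)
  sumℕ-fillsColumn≡transfer (suc l) true (true ∷ H) (true ∷ S) =
    cong₂ _+_ (sumℕ-zero l (λ V → refl)) (sumℕ-zero l (λ V → refl))
  sumℕ-fillsColumn≡transfer (suc l) true (true ∷ H) (false ∷ S) =
    cong₂ _+_ (sumℕ-zero l (λ V → refl)) (sumℕ-zero l (λ V → refl))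
  sumℕ-fillsColumn≡transfer (suc l) true (false ∷ H) (true ∷ S) =
    cong₂ _+_ (sumℕ-zero l (λ V → refl)) (sumℕ-zero l (λ V → refl))
  sumℕ-fillsColumn≡transfer (suc l) true (false ∷ H) (false ∷ S) = cong₂ _+_ (sumℕ-zero l (λ V → refl))
    (trans (sumℕ-cong l (λ V → cong bit (fillsColumn-∷ l true false false H S false V))) (sumℕ-fillsColumn≡transfer l false H S))

  columnCoverage : {l : ℕ} → ℕ → Vec Bool l → Coverage
  columnCoverage n S a b = if b ≡ᵇ n then cell S a else 0

  selectedCoverage-shift : (f g : ℕ → Dom) → (∀ i a b → coverage (f i) (suc a) b ≡ coverage (g i) a b) →
    ∀ {l} (cs : Vec Bool l) a b → selectedCoverage f cs (suc a) b ≡ selectedCoverage g cs a b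
  selectedCoverage-shift f g f≈g []           a b = refl
  selectedCoverage-shift f g f≈g (true ∷ cs)  a b =
    cong₂ _+_ (f≈g 0 a b) (selectedCoverage-shift _ _ (λ i → f≈g (suc i)) cs a b)
  selectedCoverage-shift f g f≈g (false ∷ cs) a b = selectedCoverage-shift _ _ (λ i → f≈g (suc i)) cs a b

  selectedCoverage-row0 : (f : ℕ → Dom) → (∀ i b → coverage (f i) 0 b ≡ 0) →
    ∀ {l} (cs : Vec Bool l) b → selectedCoverage f cs 0 b ≡ 0
  selectedCoverage-row0 f f≈0 []           b = refl
  selectedCoverage-row0 f f≈0 (true ∷ cs)  b = cong₂ _+_ (f≈0 0 b) (selectedCoverage-row0 _ (λ i → f≈0 (suc i)) cs b)
  selectedCoverage-row0 f f≈0 (false ∷ cs) b = selectedCoverage-row0 _ (λ i → f≈0 (suc i)) cs b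

  selectedCoverage-hor : ∀ j {l} (H : Vec Bool l) a b →
    selectedCoverage (λ i → hor i j) H a b ≡ (if (b ≡ᵇ j) ∨ (b ≡ᵇ suc j) then cell H a else 0)
  selectedCoverage-hor j [] a b with (b ≡ᵇ j) ∨ (b ≡ᵇ suc j)
  ... | true  = refl
  ... | false = refl
  selectedCoverage-hor j (c ∷ H) zero b =
    trans (cong ((if c then coverage (hor 0 j) 0 b else 0) +_) (selectedCoverage-row0 _ (λ i b → refl) H b))
          (firstRow c ((b ≡ᵇ j) ∨ (b ≡ᵇ suc j)))
    where
    firstRow : ∀ c x → (if c then (if x then 1 else 0) else 0) + 0 ≡ (if x then bit c else 0)
    firstRow true  true  = refl
    firstRow true  false = refl
    firstRow false true  = refl
    firstRow false false = refl
  selectedCoverage-hor j (c ∷ H) (suc a) b =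
    trans (cong₂ _+_ (missesRow c) (selectedCoverage-shift _ _ (λ i a b → refl) H a b)) (selectedCoverage-hor j H a b)
    where
    missesRow : ∀ c → (if c then coverage (hor 0 j) (suc a) b else 0) ≡ 0
    missesRow true  = refl
    missesRow false = refl

  selectedCoverage-ver : ∀ n {l} (V : Vec Bool l) a b →
    selectedCoverage (λ i → ver i n) V a b ≡ (if b ≡ᵇ n then verticalCoverage V a else 0)
  selectedCoverage-ver n [] a b with b ≡ᵇ n
  ... | true  = refl
  ... | false = refl
  selectedCoverage-ver n (c ∷ V) zero b =
    trans (cong ((if c then coverage (ver 0 n) 0 b else 0) +_) (selectedCoverage-row0 _ lowerMissesRow0 V b))
          (firstRow c (b ≡ᵇ n))
    where
    lowerMissesRow0 : ∀ i b → coverage (ver (suc i) n) 0 b ≡ 0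
    lowerMissesRow0 i b with b ≡ᵇ n
    ... | true  = refl
    ... | false = refl
    firstRow : ∀ c x → (if c then (if x ∧ true then 1 else 0) else 0) + 0 ≡ (if x then bit c else 0)
    firstRow true  true  = refl
    firstRow true  false = refl
    firstRow false true  = refl
    firstRow false false = refl
  selectedCoverage-ver n (c ∷ V) (suc a) b =
    trans (cong ((if c then coverage (ver 0 n) (suc a) b else 0) +_)
                (trans (selectedCoverage-shift _ _ (λ i a b → refl) V a b) (selectedCoverage-ver n V a b)))
          (laterRow c a (b ≡ᵇ n))
    where
    laterRow : ∀ c a x → (if c then (if x ∧ (a ≡ᵇ 0) then 1 else 0) else 0) + (if x then verticalCoverage V a else 0)
                           ≡ (if x then verticalCoverage (c ∷ V) (suc a) else 0)
    laterRow c     a       false with c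
    ... | true  = refl
    ... | false = refl
    laterRow true  zero    true = refl
    laterRow false zero    true = refl
    laterRow true  (suc a) true = refl
    laterRow false (suc a) true = refl

  columnwise-avoids : ∀ m n b → n ≤ b → All (Avoids b) (columnwise m n)
  columnwise-avoids m zero    b n≤b = []
  columnwise-avoids m (suc n) b n<b =
    ++⁺ (horizontalsInto-avoids n n<b)
        (++⁺ (map⁺ (universal (λ i a → verticalAvoids i a) (upTo (m ∸ 1))))
             (columnwise-avoids m n b (≤-trans (n≤1+n n) n<b)))
    where
    verticalAvoids : ∀ i a → covers (ver i n) a b ≡ false
    verticalAvoids i a rewrite ≢⇒≡ᵇ-false b n (>⇒≢ n<b) = refl
    horizontalsInto-avoids : ∀ n → suc n ≤ b → All (Avoids b) (horizontalsInto m n)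
    horizontalsInto-avoids zero    n<b = []
    horizontalsInto-avoids (suc j) n<b = map⁺ (universal (λ i a → horizontalAvoids i a) (upTo m))
      where
      horizontalAvoids : ∀ i a → covers (hor i j) a b ≡ false
      horizontalAvoids i a rewrite ≢⇒≡ᵇ-false b j (>⇒≢ (≤-trans (n≤1+n (suc j)) n<b))
                                 | ≢⇒≡ᵇ-false b (suc j) (>⇒≢ n<b) = ∧-zeroʳ (a ≡ᵇ i)

  partialTilings : (m n : ℕ) → Vec Bool m → ℕ
  partialTilings m n S = completions m n (columnwise m n) (columnCoverage (n ∸ 1) S)

  if-cong : ∀ c {x y : ℕ} → x ≡ y → (if c then x else 0) ≡ (if c then y else 0)
  if-cong c refl = refl

  partialTilings-suc : ∀ l j (S : Vec Bool (suc l)) →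
    partialTilings (suc l) (suc (suc j)) S ≡ sumℕ (suc l) (λ H → partialTilings (suc l) (suc j) H * transfer false H S)
  partialTilings-suc l j S =
    trans (cong (λ hs → completions m (suc n) (hs ++ verticalsAt m n ++ columnwise m n) K) (map-upTo (λ i → hor i j) m))
    (trans (completions-applyUpTo m (suc n) m (λ i → hor i j) (verticalsAt m n ++ columnwise m n) K)
           (sumℕ-cong m lastColumn))
    where
    m = suc l
    n = suc j
    K : Coverage
    K = columnCoverage n S
    KH : Vec Bool m → Coverage
    KH H a b = K a b + selectedCoverage (λ i → hor i j) H a b
    KHV : Vec Bool m → Vec Bool l → Coverage
    KHV H V a b = KH H a b + selectedCoverage (λ i → ver i n) V a b
    columnExact : ∀ H V → isExactColumn m n (KHV H V) ≡ fillsColumn false H S V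
    columnExact H V = cong and (applyUpTo-cong-< m (λ a _ → cong (_≡ᵇ 1)
      (cong₂ _+_ (cong₂ _+_ (fromS a) (fromH a)) (fromV a))))
      where
      fromS : ∀ a → K a n ≡ cell S a
      fromS a rewrite ≡ᵇ-refl n = refl
      fromH : ∀ a → selectedCoverage (λ i → hor i j) H a n ≡ cell H a
      fromH a rewrite selectedCoverage-hor j H a n | ≢⇒≡ᵇ-false (suc j) j (>⇒≢ (n<1+n j)) | ≡ᵇ-refl j = refl
      fromV : ∀ a → selectedCoverage (λ i → ver i n) V a n ≡ verticalCoverage V a
      fromV a rewrite selectedCoverage-ver n V a n | ≡ᵇ-refl n = refl
    earlierColumns : ∀ H V a b → a < m → b < n → KHV H V a b ≡ columnCoverage j H a b
    earlierColumns H V a b a<m b<n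
      rewrite selectedCoverage-hor j H a b | selectedCoverage-ver n V a b | ≢⇒≡ᵇ-false b (suc j) (<⇒≢ b<n)
      with b ≡ᵇ j
    ... | true  = +-identityʳ _
    ... | false = refl
    lastColumn : ∀ H → completions m (suc n) (verticalsAt m n ++ columnwise m n) (KH H)
                         ≡ partialTilings m n H * transfer false H S
    lastColumn H = begin
        completions m (suc n) (verticalsAt m n ++ columnwise m n) (KH H)
      ≡⟨ cong (λ vs → completions m (suc n) (vs ++ columnwise m n) (KH H)) (map-upTo (λ i → ver i n) l) ⟩
        completions m (suc n) (applyUpTo (λ i → ver i n) l ++ columnwise m n) (KH H)
      ≡⟨ completions-applyUpTo m (suc n) l (λ i → ver i n) (columnwise m n) (KH H) ⟩
        sumℕ l (λ V → completions m (suc n) (columnwise m n) (KHV H V))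
      ≡⟨ sumℕ-cong l (λ V → trans (completions-suc m n (columnwise m n) (KHV H V) (columnwise-avoids m n n ≤-refl))
                                  (if-cong (isExactColumn m n (KHV H V))
                                           (completions-local m n (columnwise m n) (earlierColumns H V)))) ⟩
        sumℕ l (λ V → if isExactColumn m n (KHV H V) then partialTilings m n H else 0)
      ≡⟨ sumℕ-if l (λ V → isExactColumn m n (KHV H V)) (partialTilings m n H) ⟩
        partialTilings m n H * sumℕ l (λ V → bit (isExactColumn m n (KHV H V)))
      ≡⟨ cong (partialTilings m n H *_) (trans (sumℕ-cong l (λ V → cong bit (columnExact H V)))
                                              (sumℕ-fillsColumn≡transfer l false H S)) ⟩
        partialTilings m n H * transfer false H S
      ∎
      where open ≡-Reasoning

  cell-replicate-false : ∀ l a → cell (replicate l false) a ≡ 0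
  cell-replicate-false zero    a       = refl
  cell-replicate-false (suc l) zero    = refl
  cell-replicate-false (suc l) (suc a) = cell-replicate-false l a

  partialTilings-one : ∀ l (S : Vec Bool (suc l)) → partialTilings (suc l) 1 S ≡ transfer false (replicate _ false) S
  partialTilings-one l S = begin
      completions m 1 (verticalsAt m 0 ++ []) K
    ≡⟨ cong (λ vs → completions m 1 (vs ++ []) K) (map-upTo (λ i → ver i 0) l) ⟩
      completions m 1 (applyUpTo (λ i → ver i 0) l ++ []) K
    ≡⟨ completions-applyUpTo m 1 l (λ i → ver i 0) [] K ⟩
      sumℕ l (λ V → completions m 1 [] (KV V))
    ≡⟨ sumℕ-cong l (λ V → trans (completions-suc m 0 [] (KV V) [])
                                (if-exact (isExactColumn m 0 (KV V)) (cong bit (isExactCover-zero (KV V))))) ⟩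
      sumℕ l (λ V → bit (isExactColumn m 0 (KV V)))
    ≡⟨ sumℕ-cong l (λ V → cong bit (columnExact V)) ⟩
      sumℕ l (λ V → bit (fillsColumn false (replicate _ false) S V))
    ≡⟨ sumℕ-fillsColumn≡transfer l false (replicate _ false) S ⟩
      transfer false (replicate _ false) S
    ∎
    where
    open ≡-Reasoning
    m = suc l
    K : Coverage
    K = columnCoverage 0 S
    KV : Vec Bool l → Coverage
    KV V a b = K a b + selectedCoverage (λ i → ver i 0) V a b
    isExactCover-zero : ∀ k → isExactCover m 0 k ≡ true
    isExactCover-zero k = cong and (concatMap-nil (upTo m))
    if-exact : ∀ c {x} → x ≡ 1 → (if c then x else 0) ≡ bit c
    if-exact true  refl = refl
    if-exact false _    = refl
    columnExact : ∀ V → isExactColumn m 0 (KV V) ≡ fillsColumn false (replicate m false) S V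
    columnExact V = cong and (applyUpTo-cong-< m (λ a _ → cong (_≡ᵇ 1)
      (trans (cong (cell S a +_) (selectedCoverage-ver 0 V a 0))
             (cong (_+ verticalCoverage V a) (sym (trans (cong (cell S a +_) (cell-replicate-false m a)) (+-identityʳ _)))))))

  tilingCount≡partialTilings : ∀ l n → tilingCount (suc l) (suc n) ≡ partialTilings (suc l) (suc n) (replicate _ false)
  tilingCount≡partialTilings l n =
    trans (tilingCount≡completions (suc l) (suc n))
      (trans (completions-↭ (suc l) (suc n) (placements↭columnwise (suc l) (suc n)) _)
             (completions-cong (suc l) (suc n) (columnwise (suc l) (suc n)) (λ a b → nothingPlaced (b ≡ᵇ n) a)))
    where
    nothingPlaced : ∀ c a → 0 ≡ (if c then cell (replicate (suc l) false) a else 0)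
    nothingPlaced true  a = sym (cell-replicate-false (suc l) a)
    nothingPlaced false a = refl

module IntegerSums where

  open import Data.Bool using (true; false; not)
  open import Data.Integer using (ℤ; +_; _+_; _*_; 0ℤ; 1ℤ)
  open import Data.Integer.Properties using (+-identityʳ; +-identityˡ; +-comm; *-zeroʳ; *-identityʳ; *-comm; *-distribˡ-+; pos-+)
  open import Data.Integer.Properties using (+-commutativeSemigroup)
  open import Algebra.Properties.CommutativeSemigroup +-commutativeSemigroup using (interchange)
  open import Data.List using (List; []; _∷_; _++_; map)
  open import Data.List.Membership.Propositional using (_∈_)
  open import Data.List.Membership.Propositional.Properties using (∈-map⁺)
  open import Data.List.Relation.Unary.Any using (here)
  open import Data.List.Relation.Unary.Any.Properties using (++⁺ˡ; ++⁺ʳ)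
  open import Data.Nat using (zero; suc)
  open import Data.Vec using (Vec; []; _∷_)
  open import Relation.Binary.PropositionalEquality using (_≡_; refl; sym; trans; cong₂)
  open ColumnDecomposition using (sumℕ)

  sumℤ : (l : ℕ) → (Vec Bool l → ℤ) → ℤ
  sumℤ zero    g = g []
  sumℤ (suc l) g = sumℤ l (λ v → g (true ∷ v)) + sumℤ l (λ v → g (false ∷ v))

  sumℤ-cong : ∀ l {g h : Vec Bool l → ℤ} → (∀ v → g v ≡ h v) → sumℤ l g ≡ sumℤ l h
  sumℤ-cong zero    g≗h = g≗h []
  sumℤ-cong (suc l) g≗h = cong₂ _+_ (sumℤ-cong l (λ v → g≗h (true ∷ v))) (sumℤ-cong l (λ v → g≗h (false ∷ v)))

  sumℤ-*ˡ : ∀ l (c : ℤ) (g : Vec Bool l → ℤ) → sumℤ l (λ v → c * g v) ≡ c * sumℤ l g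
  sumℤ-*ˡ zero    c g = refl
  sumℤ-*ˡ (suc l) c g = trans (cong₂ _+_ (sumℤ-*ˡ l c _) (sumℤ-*ˡ l c _)) (sym (*-distribˡ-+ c _ _))

  sumℤ-*ʳ : ∀ l (g : Vec Bool l → ℤ) (c : ℤ) → sumℤ l (λ v → g v * c) ≡ sumℤ l g * c
  sumℤ-*ʳ l g c = trans (sumℤ-cong l (λ v → *-comm (g v) c)) (trans (sumℤ-*ˡ l c g) (*-comm c _))

  sumℤ-zero : ∀ l {g : Vec Bool l → ℤ} → (∀ v → g v ≡ 0ℤ) → sumℤ l g ≡ 0ℤ
  sumℤ-zero zero    g≗0 = g≗0 []
  sumℤ-zero (suc l) g≗0 = cong₂ _+_ (sumℤ-zero l (λ v → g≗0 (true ∷ v))) (sumℤ-zero l (λ v → g≗0 (false ∷ v)))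

  sumℤ-+ : ∀ l (g h : Vec Bool l → ℤ) → sumℤ l (λ v → g v + h v) ≡ sumℤ l g + sumℤ l h
  sumℤ-+ zero    g h = refl
  sumℤ-+ (suc l) g h =
    trans (cong₂ _+_ (sumℤ-+ l (λ v → g (true ∷ v)) (λ v → h (true ∷ v))) (sumℤ-+ l (λ v → g (false ∷ v)) (λ v → h (false ∷ v))))
          (interchange (sumℤ l (λ v → g (true ∷ v))) (sumℤ l (λ v → h (true ∷ v)))
                       (sumℤ l (λ v → g (false ∷ v))) (sumℤ l (λ v → h (false ∷ v))))

  sumℤ-swap : ∀ l l′ (f : Vec Bool l → Vec Bool l′ → ℤ) →
    sumℤ l (λ s → sumℤ l′ (λ t → f s t)) ≡ sumℤ l′ (λ t → sumℤ l (λ s → f s t))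
  sumℤ-swap zero    l′ f = refl
  sumℤ-swap (suc l) l′ f = trans (cong₂ _+_ (sumℤ-swap l l′ _) (sumℤ-swap l l′ _)) (sym (sumℤ-+ l′ _ _))

  sumℕ-ℤ : ∀ l (g : Vec Bool l → ℕ) → + sumℕ l g ≡ sumℤ l (λ v → + g v)
  sumℕ-ℤ zero    g = refl
  sumℕ-ℤ (suc l) g = trans (pos-+ (sumℕ l _) (sumℕ l _)) (cong₂ _+_ (sumℕ-ℤ l _) (sumℕ-ℤ l _))

  δ : {l : ℕ} → Vec Bool l → Vec Bool l → ℤ
  δ []          []          = 1ℤ
  δ (true ∷ s)  (true ∷ u)  = δ s u
  δ (false ∷ s) (false ∷ u) = δ s u
  δ (true ∷ s)  (false ∷ u) = 0ℤ
  δ (false ∷ s) (true ∷ u)  = 0ℤ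

  δ-sym : ∀ {l} (s u : Vec Bool l) → δ s u ≡ δ u s
  δ-sym []          []          = refl
  δ-sym (true ∷ s)  (true ∷ u)  = δ-sym s u
  δ-sym (false ∷ s) (false ∷ u) = δ-sym s u
  δ-sym (true ∷ s)  (false ∷ u) = refl
  δ-sym (false ∷ s) (true ∷ u)  = refl

  sumℤ-δ : ∀ l (f : Vec Bool l → ℤ) (u : Vec Bool l) → sumℤ l (λ s → f s * δ s u) ≡ f u
  sumℤ-δ zero    f []         = *-identityʳ (f [])
  sumℤ-δ (suc l) f (true ∷ u) =
    trans (cong₂ _+_ (sumℤ-δ l (λ v → f (true ∷ v)) u) (sumℤ-zero l (λ v → *-zeroʳ (f (false ∷ v))))) (+-identityʳ _)
  sumℤ-δ (suc l) f (false ∷ u) =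
    trans (cong₂ _+_ (sumℤ-zero l (λ v → *-zeroʳ (f (true ∷ v)))) (sumℤ-δ l (λ v → f (false ∷ v)) u)) (+-identityˡ _)

  complement : {l : ℕ} → Vec Bool l → Vec Bool l
  complement []      = []
  complement (b ∷ v) = not b ∷ complement v

  sumℤ-complement : ∀ l (g : Vec Bool l → ℤ) → sumℤ l (λ s → g (complement s)) ≡ sumℤ l g
  sumℤ-complement zero    g = refl
  sumℤ-complement (suc l) g =
    trans (cong₂ _+_ (sumℤ-complement l (λ v → g (false ∷ v))) (sumℤ-complement l (λ v → g (true ∷ v))))
          (+-comm (sumℤ l (λ v → g (false ∷ v))) (sumℤ l (λ v → g (true ∷ v))))

  allVecs : (m : ℕ) → List (Vec Bool m)
  allVecs zero    = [] ∷ []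
  allVecs (suc m) = map (true ∷_) (allVecs m) ++ map (false ∷_) (allVecs m)

  ∈-allVecs : ∀ {m} (v : Vec Bool m) → v ∈ allVecs m
  ∈-allVecs []                = here refl
  ∈-allVecs (true ∷ v)        = ++⁺ˡ (∈-map⁺ (true ∷_) (∈-allVecs v))
  ∈-allVecs {suc m} (false ∷ v) = ++⁺ʳ (map (true ∷_) (allVecs m)) (∈-map⁺ (false ∷_) (∈-allVecs v))

module LinearDependence {I : Set} where

  open IntegerProperties
  open import Data.Integer using (ℤ; _+_; _*_; -_; _-_; 0ℤ; 1ℤ; _≟_)
  open import Data.Integer.Properties using (+-identityʳ; +-identityˡ; *-zeroʳ)
  import Data.Integer.Properties as ℤ
  open import Data.Integer.Tactic.RingSolver using (solve-∀)
  open import Data.List using (List; []; _∷_; _++_; [_]; map; length)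
  open import Data.List.Properties using (length-map; length-++; ++-identityʳ; ++-assoc)
  open import Data.List.Membership.Propositional using (_∈_)
  open import Data.List.Relation.Unary.All using (All; []; _∷_)
  import Data.List.Relation.Unary.All.Properties as All
  open import Data.List.Relation.Unary.Any as Any using (Any; here; there)
  import Data.List.Relation.Unary.Any.Properties as Any
  open import Data.Nat as ℕ using (suc; _<_; _≤_)
  import Data.Nat.Properties as ℕₚ
  open import Data.Product using (Σ; _×_; _,_)
  open import Data.Sum using (inj₁; inj₂)
  open import Relation.Binary.PropositionalEquality using (_≡_; _≢_; refl; sym; trans; cong; cong₂; subst; module ≡-Reasoning)
  open import Relation.Nullary using (yes; no)

  lincomb : List ℤ → List (I → ℤ) → I → ℤ
  lincomb []       vs       p = 0ℤ
  lincomb (c ∷ cs) []       p = 0ℤ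
  lincomb (c ∷ cs) (v ∷ vs) p = c * v p + lincomb cs vs p

  VanishingCombination : List I → List (I → ℤ) → Set
  VanishingCombination pts vs =
    Σ (List ℤ) λ cs → length cs ≡ length vs × Any (λ c → c ≢ 0ℤ) cs × (∀ q → q ∈ pts → lincomb cs vs q ≡ 0ℤ)

  lincomb-++ : ∀ cz cw Z W q → length cz ≡ length Z → lincomb (cz ++ cw) (Z ++ W) q ≡ lincomb cz Z q + lincomb cw W q
  lincomb-++ []       cw []      W q _     = sym (+-identityˡ _)
  lincomb-++ (c ∷ cz) cw (z ∷ Z) W q |cz| =
    trans (cong (c * z q +_) (lincomb-++ cz cw Z W q (ℕₚ.suc-injective |cz|))) (sym (ℤ.+-assoc (c * z q) _ _))

  lincomb-vanishing : ∀ cs Z p → All (λ z → z p ≡ 0ℤ) Z → lincomb cs Z p ≡ 0ℤ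
  lincomb-vanishing []       Z       p _            = refl
  lincomb-vanishing (c ∷ cs) []      p _            = refl
  lincomb-vanishing (c ∷ cs) (z ∷ Z) p (zp≡0 ∷ Z-p) rewrite zp≡0 | lincomb-vanishing cs Z p Z-p =
    trans (+-identityʳ (c * 0ℤ)) (*-zeroʳ c)

  lincomb-*ˡ : ∀ k cs vs q → lincomb (map (k *_) cs) vs q ≡ k * lincomb cs vs q
  lincomb-*ˡ k []       vs       q = sym (*-zeroʳ k)
  lincomb-*ˡ k (c ∷ cs) []       q = sym (*-zeroʳ k)
  lincomb-*ˡ k (c ∷ cs) (v ∷ vs) q rewrite lincomb-*ˡ k cs vs q = distrib k c (v q) (lincomb cs vs q)
    where
    distrib : ∀ k c x y → k * c * x + k * y ≡ k * (c * x + y)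
    distrib = solve-∀

  eliminate : (I → ℤ) → I → (I → ℤ) → I → ℤ
  eliminate v p w q = v p * w q - w p * v q

  lincomb-eliminate : ∀ v p cs ws q → lincomb cs (map (eliminate v p) ws) q ≡ v p * lincomb cs ws q - lincomb cs ws p * v q
  lincomb-eliminate v p []       ws       q = sym (zero (v p) (v q))
    where
    zero : ∀ a b → a * 0ℤ - 0ℤ * b ≡ 0ℤ
    zero = solve-∀
  lincomb-eliminate v p (c ∷ cs) []       q = sym (zero (v p) (v q))
    where
    zero : ∀ a b → a * 0ℤ - 0ℤ * b ≡ 0ℤ
    zero = solve-∀
  lincomb-eliminate v p (c ∷ cs) (w ∷ ws) q rewrite lincomb-eliminate v p cs ws q =
    regroup c (v p) (v q) (w p) (w q) (lincomb cs ws q) (lincomb cs ws p)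
    where
    regroup : ∀ c a b x y L M → c * (a * y - x * b) + (a * L - M * b) ≡ a * (c * y + L) - (c * x + M) * b
    regroup = solve-∀

  split : {X : Set} (Z : List X) (n : ℕ) (cs : List ℤ) → length cs ≡ length Z ℕ.+ n →
    Σ (List ℤ) λ cz → Σ (List ℤ) λ cw → cs ≡ cz ++ cw × length cz ≡ length Z × length cw ≡ n
  split []      n cs       |cs| = [] , cs , refl , refl , |cs|
  split (z ∷ Z) n (c ∷ cs) |cs| with split Z n cs (ℕₚ.suc-injective |cs|)
  ... | cz , cw , refl , |cz| , |cw| = c ∷ cz , cw , refl , cong suc |cz| , |cw|

  lincomb-pivot : ∀ v p cz cw Z ws q → length cz ≡ length Z →
    lincomb (cz ++ (- lincomb cw ws p) ∷ map (v p *_) cw) (Z ++ v ∷ ws) q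
      ≡ lincomb (cz ++ cw) (Z ++ map (eliminate v p) ws) q
  lincomb-pivot v p cz cw Z ws q |cz| = begin
      lincomb (cz ++ a ∷ map (v p *_) cw) (Z ++ v ∷ ws) q
    ≡⟨ lincomb-++ cz _ Z _ q |cz| ⟩
      lincomb cz Z q + (a * v q + lincomb (map (v p *_) cw) ws q)
    ≡⟨ cong (λ x → lincomb cz Z q + (a * v q + x)) (lincomb-*ˡ (v p) cw ws q) ⟩
      lincomb cz Z q + (a * v q + v p * lincomb cw ws q)
    ≡⟨ cong (lincomb cz Z q +_) (regroup (lincomb cw ws p) (v q) (v p) (lincomb cw ws q)) ⟩
      lincomb cz Z q + (v p * lincomb cw ws q - lincomb cw ws p * v q)
    ≡⟨ cong (lincomb cz Z q +_) (lincomb-eliminate v p cw ws q) ⟨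
      lincomb cz Z q + lincomb cw (map (eliminate v p) ws) q
    ≡⟨ lincomb-++ cz cw Z _ q |cz| ⟨
      lincomb (cz ++ cw) (Z ++ map (eliminate v p) ws) q
    ∎
    where
    open ≡-Reasoning
    a = - lincomb cw ws p
    regroup : ∀ Lp vq vp Lq → - Lp * vq + vp * Lq ≡ vp * Lq - Lp * vq
    regroup = solve-∀

  extend-vanishing : ∀ p pts Z → All (λ z → z p ≡ 0ℤ) Z →
    VanishingCombination pts Z → VanishingCombination (p ∷ pts) Z
  extend-vanishing p pts Z Z-p (cs , |cs| , nonzero , vanishes) = cs , |cs| , nonzero , vanishes′
    where
    vanishes′ : ∀ q → q ∈ p ∷ pts → lincomb cs Z q ≡ 0ℤ
    vanishes′ q (here refl) = lincomb-vanishing cs Z p Z-p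
    vanishes′ q (there q∈) = vanishes q q∈

  extend-by-pivot : ∀ p pts Z v ws → v p ≢ 0ℤ → All (λ z → z p ≡ 0ℤ) Z →
    VanishingCombination pts (Z ++ map (eliminate v p) ws) → VanishingCombination (p ∷ pts) (Z ++ v ∷ ws)
  extend-by-pivot p pts Z v ws vp≢0 Z-p (cs′ , |cs′| , nonzero , vanishes)
    with split Z (length ws) cs′ (trans |cs′| (trans (length-++ Z) (cong (length Z ℕ.+_) (length-map _ ws))))
  ... | cz , cw , refl , |cz| , |cw| = cs , |cs| , nonzero′ , vanishes′
    where
    cs : List ℤ
    cs = cz ++ (- lincomb cw ws p) ∷ map (v p *_) cw
    |cs| : length cs ≡ length (Z ++ v ∷ ws)
    |cs| = trans (length-++ cz) (trans (cong₂ ℕ._+_ |cz| (cong suc (trans (length-map _ cw) |cw|))) (sym (length-++ Z)))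
    nonzero′ : Any (λ c → c ≢ 0ℤ) cs
    nonzero′ with Any.++⁻ cz nonzero
    ... | inj₁ inCz = Any.++⁺ˡ inCz
    ... | inj₂ inCw = Any.++⁺ʳ cz (there (Any.map⁺ (Any.map (i*j≢0 vp≢0) inCw)))
    vanishes′ : ∀ q → q ∈ p ∷ pts → lincomb cs (Z ++ v ∷ ws) q ≡ 0ℤ
    vanishes′ q (here refl) = begin
        lincomb cs (Z ++ v ∷ ws) p
      ≡⟨ lincomb-pivot v p cz cw Z ws p |cz| ⟩
        lincomb (cz ++ cw) (Z ++ map (eliminate v p) ws) p
      ≡⟨ lincomb-++ cz cw Z _ p |cz| ⟩
        lincomb cz Z p + lincomb cw (map (eliminate v p) ws) p
      ≡⟨ cong₂ _+_ (lincomb-vanishing cz Z p Z-p) (lincomb-eliminate v p cw ws p) ⟩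
        0ℤ + (v p * lincomb cw ws p - lincomb cw ws p * v p)
      ≡⟨ cancel (v p) (lincomb cw ws p) ⟩
        0ℤ
      ∎
      where
      open ≡-Reasoning
      cancel : ∀ a L → 0ℤ + (a * L - L * a) ≡ 0ℤ
      cancel = solve-∀
    vanishes′ q (there q∈) = trans (lincomb-pivot v p cz cw Z ws q |cz|) (vanishes q q∈)

  -- Gaussian elimination: pivot on a vector not vanishing at the first point, eliminate it from the rest, recurse.
  vanishingCombination : ∀ (pts : List I) (vs : List (I → ℤ)) → length pts < length vs → VanishingCombination pts vs
  vanishingCombination []        (v ∷ vs) _ =
    1ℤ ∷ map (λ _ → 0ℤ) vs , cong suc (length-map _ vs) , here (λ ()) , (λ q ())
  vanishingCombination (p ∷ pts) vs       |pts|<|vs| = pivot [] vs [] |pts|<|vs|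
    where
    pivot : ∀ Z ws → All (λ z → z p ≡ 0ℤ) Z → suc (length pts) < length Z ℕ.+ length ws →
      VanishingCombination (p ∷ pts) (Z ++ ws)
    pivot Z [] Z-p bound =
      subst (VanishingCombination (p ∷ pts)) (sym (++-identityʳ Z))
        (extend-vanishing p pts Z Z-p (vanishingCombination pts Z
          (ℕₚ.≤-trans (ℕₚ.n≤1+n _) (subst (suc (suc (length pts)) ≤_) (ℕₚ.+-identityʳ _) bound))))
    pivot Z (v ∷ ws) Z-p bound with v p ≟ 0ℤ
    ... | yes vp≡0 =
      subst (VanishingCombination (p ∷ pts)) (++-assoc Z [ v ] ws)
        (pivot (Z ++ [ v ]) ws (All.++⁺ Z-p (vp≡0 ∷ [])) (subst (suc (length pts) <_) moveLength bound))
      where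
      moveLength : length Z ℕ.+ suc (length ws) ≡ length (Z ++ [ v ]) ℕ.+ length ws
      moveLength = trans (ℕₚ.+-suc (length Z) (length ws))
                         (cong (ℕ._+ length ws) (trans (ℕₚ.+-comm 1 (length Z)) (sym (length-++ Z))))
    ... | no vp≢0 =
      extend-by-pivot p pts Z v ws vp≢0 Z-p (vanishingCombination pts (Z ++ map (eliminate v p) ws)
        (subst (length pts <_) (sym (trans (length-++ Z) (cong (length Z ℕ.+_) (length-map _ ws))))
               (ℕₚ.≤-pred (subst (suc (length pts) <_) (ℕₚ.+-suc (length Z) (length ws)) bound))))

module Recurrences where

  open IntegerProperties
  open import Data.Empty using (⊥-elim)
  open import Data.Integer using (ℤ; +_; -[1+_]; _+_; _*_; -_; _-_; 0ℤ; 1ℤ; _≟_)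
  open import Data.Integer.Properties using (+-identityʳ; +-identityˡ; +-assoc; *-zeroʳ; +-inverseʳ; i-j≡0⇒i≡j)
  open import Data.Integer.Tactic.RingSolver using (solve-∀)
  open import Data.List using ([]; _∷_)
  open import Data.List.Relation.Unary.Any using (Any; here; there)
  open import Data.Nat as ℕ using (zero; suc)
  open import Relation.Binary.PropositionalEquality using (_≡_; _≢_; refl; sym; trans; cong; cong₂; module ≡-Reasoning)
  open import Relation.Nullary using (yes; no)

  recSum-local : ∀ cs (f g : ℤ → ℤ) n → (∀ j → f (n + + j) ≡ g (n + + j)) → recSum cs f n ≡ recSum cs g n
  recSum-local []       f g n f≗g = refl
  recSum-local (c ∷ cs) f g n f≗g =
    cong₂ _+_ (cong (c *_) (trans (sym (cong f (+-identityʳ n))) (trans (f≗g 0) (cong g (+-identityʳ n)))))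
              (recSum-local cs f g (n + 1ℤ) (λ j → trans (cong f (+-assoc n 1ℤ (+ j)))
                                                   (trans (f≗g (suc j)) (sym (cong g (+-assoc n 1ℤ (+ j)))))))

  recSum-cong : ∀ cs {f g : ℤ → ℤ} n → (∀ x → f x ≡ g x) → recSum cs f n ≡ recSum cs g n
  recSum-cong cs {f} {g} n f≗g = recSum-local cs f g n (λ j → f≗g _)

  recSum-zero : ∀ cs n → recSum cs (λ _ → 0ℤ) n ≡ 0ℤ
  recSum-zero []       n = refl
  recSum-zero (c ∷ cs) n = cong₂ _+_ (*-zeroʳ c) (recSum-zero cs (n + 1ℤ))

  recSum-+ : ∀ cs (f g : ℤ → ℤ) n → recSum cs (λ x → f x + g x) n ≡ recSum cs f n + recSum cs g n
  recSum-+ []       f g n = refl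
  recSum-+ (c ∷ cs) f g n rewrite recSum-+ cs f g (n + 1ℤ) =
    regroup c (f n) (g n) (recSum cs f (n + 1ℤ)) (recSum cs g (n + 1ℤ))
    where
    regroup : ∀ c a b x y → c * (a + b) + (x + y) ≡ c * a + x + (c * b + y)
    regroup = solve-∀

  recSum-*ˡ : ∀ cs k (f : ℤ → ℤ) n → recSum cs (λ x → k * f x) n ≡ k * recSum cs f n
  recSum-*ˡ []       k f n = sym (*-zeroʳ k)
  recSum-*ˡ (c ∷ cs) k f n rewrite recSum-*ˡ cs k f (n + 1ℤ) = regroup c k (f n) (recSum cs f (n + 1ℤ))
    where
    regroup : ∀ c k a x → c * (k * a) + k * x ≡ k * (c * a + x)
    regroup = solve-∀

  recSum-neg : ∀ cs (f : ℤ → ℤ) n → recSum cs (λ x → - f x) n ≡ - recSum cs f n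
  recSum-neg []       f n = refl
  recSum-neg (c ∷ cs) f n rewrite recSum-neg cs f (n + 1ℤ) = regroup c (f n) (recSum cs f (n + 1ℤ))
    where
    regroup : ∀ c a x → c * (- a) + - x ≡ - (c * a + x)
    regroup = solve-∀

  recSum-shift : ∀ cs (f : ℤ → ℤ) n → recSum cs (λ x → f (x + 1ℤ)) n ≡ recSum cs f (n + 1ℤ)
  recSum-shift []       f n = refl
  recSum-shift (c ∷ cs) f n = cong (λ x → c * f (n + 1ℤ) + x) (recSum-shift cs f (n + 1ℤ))

  recSum-comm : ∀ ps cs (f : ℤ → ℤ) n → recSum ps (λ x → recSum cs f x) n ≡ recSum cs (λ x → recSum ps f x) n
  recSum-comm []       cs f n = sym (recSum-zero cs n)
  recSum-comm (p ∷ ps) cs f n = begin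
      p * recSum cs f n + recSum ps (λ x → recSum cs f x) (n + 1ℤ)
    ≡⟨ cong (λ x → p * recSum cs f n + x) (recSum-comm ps cs f (n + 1ℤ)) ⟩
      p * recSum cs f n + recSum cs (λ x → recSum ps f x) (n + 1ℤ)
    ≡⟨ cong₂ _+_ (recSum-*ˡ cs p f n) (recSum-shift cs (λ x → recSum ps f x) n) ⟨
      recSum cs (λ x → p * f x) n + recSum cs (λ x → recSum ps f (x + 1ℤ)) n
    ≡⟨ recSum-+ cs _ _ n ⟨
      recSum cs (λ x → p * f x + recSum ps f (x + 1ℤ)) n
    ∎
    where open ≡-Reasoning

  -- Run the recurrence backwards from its first non-zero coefficient.
  recurrent-vanishing : ∀ cs → Any (λ c → c ≢ 0ℤ) cs → ∀ (g : ℤ → ℤ) → (∀ n → recSum cs g n ≡ 0ℤ) →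
    (∀ i → g (+ suc i) ≡ 0ℤ) → ∀ n → g n ≡ 0ℤ
  recurrent-vanishing (c ∷ cs) nonzero g rec pos n with c ≟ 0ℤ
  recurrent-vanishing (c ∷ cs) (here c≢0)     g rec pos n | yes c≡0 = ⊥-elim (c≢0 c≡0)
  recurrent-vanishing (c ∷ cs) (there nonzero) g rec pos n | yes c≡0 = recurrent-vanishing cs nonzero g rec′ pos n
    where
    rec′ : ∀ x → recSum cs g x ≡ 0ℤ
    rec′ x = begin
        recSum cs g x
      ≡⟨ cong (recSum cs g) (pred-suc x) ⟨
        recSum cs g (x - 1ℤ + 1ℤ)
      ≡⟨ +-identityˡ _ ⟨
        0ℤ + recSum cs g (x - 1ℤ + 1ℤ)
      ≡⟨ cong (λ a → a * g (x - 1ℤ) + recSum cs g (x - 1ℤ + 1ℤ)) c≡0 ⟨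
        c * g (x - 1ℤ) + recSum cs g (x - 1ℤ + 1ℤ)
      ≡⟨ rec (x - 1ℤ) ⟩
        0ℤ
      ∎
      where
      open ≡-Reasoning
      pred-suc : ∀ x → x - 1ℤ + 1ℤ ≡ x
      pred-suc = solve-∀
  recurrent-vanishing (c ∷ cs) nonzero g rec pos n | no c≢0 = vanishes n
    where
    below : ∀ k i → g (+ suc i - + k) ≡ 0ℤ
    below zero    i = trans (cong g (+-identityʳ (+ suc i))) (pos i)
    below (suc k) i = i*j≡0⇒j≡0 c≢0 leading
      where
      x = + suc i - + suc k
      tail≡0 : recSum cs g (x + 1ℤ) ≡ 0ℤ
      tail≡0 = trans (recSum-local cs g (λ _ → 0ℤ) (x + 1ℤ) (λ j → trans (cong g (shift (+ i) (+ j) (+ k))) (below k (i ℕ.+ j))))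
                     (recSum-zero cs (x + 1ℤ))
        where
        shift : ∀ a b d → (1ℤ + a - (1ℤ + d) + 1ℤ) + b ≡ 1ℤ + (a + b) - d
        shift = solve-∀
      leading : c * g x ≡ 0ℤ
      leading = trans (sym (+-identityʳ (c * g x))) (trans (cong (λ y → c * g x + y) (sym tail≡0)) (rec x))
    vanishes : ∀ n → g n ≡ 0ℤ
    vanishes (+ j)    = below 1 j
    vanishes -[1+ j ] = below (suc (suc j)) 0

  -- Applying one recurrence to the other shows that the difference satisfies the second one.
  recurrent-unique : ∀ (f h : ℤ → ℤ) ps cs → Any (λ c → c ≢ 0ℤ) ps → Any (λ c → c ≢ 0ℤ) cs →
    (∀ n → recSum ps f n ≡ 0ℤ) → (∀ n → recSum cs h n ≡ 0ℤ) → (∀ i → f (+ suc i) ≡ h (+ suc i)) → ∀ n → f n ≡ h n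
  recurrent-unique f h ps cs ps≢0 cs≢0 rec-f rec-h agree n =
    i-j≡0⇒i≡j (f n) (h n) (recurrent-vanishing cs cs≢0 d rec-d d-pos n)
    where
    r : ℤ → ℤ
    r x = recSum cs f x
    rec-r : ∀ n → recSum ps r n ≡ 0ℤ
    rec-r n = trans (recSum-comm ps cs f n) (trans (recSum-cong cs n rec-f) (recSum-zero cs n))
    r-pos : ∀ i → r (+ suc i) ≡ 0ℤ
    r-pos i = trans (recSum-local cs f h (+ suc i) (λ j → agree (i ℕ.+ j))) (rec-h (+ suc i))
    rec-cs-f : ∀ n → recSum cs f n ≡ 0ℤ
    rec-cs-f = recurrent-vanishing ps ps≢0 r rec-r r-pos
    d : ℤ → ℤ
    d x = f x - h x
    rec-d : ∀ n → recSum cs d n ≡ 0ℤ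
    rec-d n = trans (recSum-+ cs f (λ x → - h x) n)
                    (cong₂ _+_ (rec-cs-f n) (trans (recSum-neg cs h n) (cong -_ (rec-h n))))
    d-pos : ∀ i → d (+ suc i) ≡ 0ℤ
    d-pos i = trans (cong (_- h (+ suc i)) (agree i)) (+-inverseʳ (h (+ suc i)))

module TransferInverse where

  open IntegerSums
  open TransferMatrix using (transfer)
  open import Data.Bool using (true; false; not)
  open import Data.Integer using (ℤ; +_; _+_; _*_; -_; 0ℤ; 1ℤ; -1ℤ)
  open import Data.Integer.Properties using (+-identityʳ; +-identityˡ; *-zeroʳ; *-identityˡ)
  open import Data.Integer.Tactic.RingSolver using (solve-∀)
  open import Data.Nat using (zero; suc)
  open import Data.Vec using (Vec; []; _∷_; replicate)
  open import Relation.Binary.PropositionalEquality using (_≡_; refl; sym; trans; cong; cong₂)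

  transferℤ : {l : ℕ} → Bool → Vec Bool l → Vec Bool l → ℤ
  transferℤ p s t = + transfer p s t

  transfer-sym : ∀ {l} p (s t : Vec Bool l) → transfer p s t ≡ transfer p t s
  transfer-sym false []          []          = refl
  transfer-sym true  []          []          = refl
  transfer-sym false (true ∷ s)  (true ∷ t)  = refl
  transfer-sym false (true ∷ s)  (false ∷ t) = transfer-sym false s t
  transfer-sym false (false ∷ s) (true ∷ t)  = transfer-sym false s t
  transfer-sym false (false ∷ s) (false ∷ t) = transfer-sym true s t
  transfer-sym true  (false ∷ s) (false ∷ t) = transfer-sym false s t
  transfer-sym true  (true ∷ s)  (true ∷ t)  = refl
  transfer-sym true  (true ∷ s)  (false ∷ t) = refl
  transfer-sym true  (false ∷ s) (true ∷ t)  = refl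

  sign : Bool → ℤ
  sign false = 1ℤ
  sign true  = -1ℤ

  sign-sq : ∀ c → sign c * sign c ≡ 1ℤ
  sign-sq false = refl
  sign-sq true  = refl

  sign-not : ∀ c → sign (not c) ≡ - sign c
  sign-not false = refl
  sign-not true  = refl

  -- χ c t is the product of the signs (−1)^(i + [c]) over the rows i marked in t.
  χ : {l : ℕ} → Bool → Vec Bool l → ℤ
  χ c []          = 1ℤ
  χ c (true ∷ t)  = sign c * χ (not c) t
  χ c (false ∷ t) = χ (not c) t

  χ-sq : ∀ {l} c (t : Vec Bool l) → χ c t * χ c t ≡ 1ℤ
  χ-sq c []          = refl
  χ-sq c (true ∷ t)  = trans (regroup (sign c) (χ (not c) t)) (cong₂ _*_ (sign-sq c) (χ-sq (not c) t))
    where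
    regroup : ∀ g a → g * a * (g * a) ≡ g * g * (a * a)
    regroup = solve-∀
  χ-sq c (false ∷ t) = χ-sq (not c) t

  σ : ℕ → Bool → ℤ
  σ m c = χ c (replicate m true)

  σ-sq : ∀ m c → σ m c * σ m c ≡ 1ℤ
  σ-sq m c = χ-sq c (replicate m true)

  δ₀₁ : {l : ℕ} → Vec Bool l → Vec Bool l → ℤ
  δ₀₁ []          []          = 0ℤ
  δ₀₁ (false ∷ s) (true ∷ u)  = δ s u
  δ₀₁ (true ∷ s)  u           = 0ℤ
  δ₀₁ (false ∷ s) (false ∷ u) = 0ℤ

  twistedProduct : (l : ℕ) → Bool → Bool → Bool → Vec Bool l → Vec Bool l → ℤ
  twistedProduct l p q c s u = sumℤ l (λ t → transferℤ p s t * χ c t * transferℤ q (complement t) (complement u))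

  twistedProduct-*ˡ : ∀ l p q c (s u : Vec Bool l) g →
    sumℤ l (λ t → transferℤ p s t * (g * χ c t) * transferℤ q (complement t) (complement u)) ≡ g * twistedProduct l p q c s u
  twistedProduct-*ˡ l p q c s u g =
    trans (sumℤ-cong l (λ t → regroup (transferℤ p s t) g (χ c t) (transferℤ q (complement t) (complement u))))
          (sumℤ-*ˡ l g _)
    where
    regroup : ∀ a g d b → a * (g * d) * b ≡ g * (a * d * b)
    regroup = solve-∀

  sumℤ-*0 : ∀ l (X Y : Vec Bool l → ℤ) → sumℤ l (λ t → X t * Y t * + 0) ≡ 0ℤ
  sumℤ-*0 l X Y = sumℤ-zero l (λ t → *-zeroʳ (X t * Y t))

  0+0≡a*0*d : ∀ a d → 0ℤ + 0ℤ ≡ a * 0ℤ * d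
  0+0≡a*0*d = solve-∀

  *-cancel-sq : ∀ g x → g * g ≡ 1ℤ → x ≡ g * g * x
  *-cancel-sq g x g²≡1 = trans (sym (*-identityˡ x)) (cong (_* x) (sym g²≡1))

  -- Expanding along the first row; the two mixed terms of twistedProduct-ff cancel.
  mutual
    twistedProduct-ff : ∀ l c (s u : Vec Bool l) → twistedProduct l false false c s u ≡ σ l c * χ c u * δ s u
    twistedProduct-ff zero c [] [] = refl
    twistedProduct-ff (suc l) c (true ∷ s) (true ∷ u) =
      trans (cong₂ _+_ (sumℤ-zero l (λ t → refl)) (twistedProduct-ff l (not c) s u))
        (trans (+-identityˡ _) (trans (*-cancel-sq (sign c) _ (sign-sq c)) (regroup (sign c) (σ l (not c)) (χ (not c) u) (δ s u))))
      where
      regroup : ∀ g a d e → g * g * (a * d * e) ≡ g * a * (g * d) * e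
      regroup = solve-∀
    twistedProduct-ff (suc l) c (true ∷ s) (false ∷ u) =
      trans (cong₂ _+_ (sumℤ-zero l (λ t → refl)) (sumℤ-*0 l (transferℤ false s) (χ (not c))))
            (sym (*-zeroʳ (σ (suc l) c * χ c (false ∷ u))))
    twistedProduct-ff (suc l) c (false ∷ s) (true ∷ u) =
      trans (cong₂ _+_ (twistedProduct-*ˡ l false true (not c) s u (sign c)) (twistedProduct-tf l (not c) s u))
            (trans (twistedProduct-ft-cancels l c s u) (sym (*-zeroʳ (σ (suc l) c * χ c (true ∷ u)))))
    twistedProduct-ff (suc l) c (false ∷ s) (false ∷ u) =
      trans (cong₂ _+_ (trans (twistedProduct-*ˡ l false false (not c) s u (sign c)) (cong (sign c *_) (twistedProduct-ff l (not c) s u)))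
                       (sumℤ-*0 l (transferℤ true s) (χ (not c))))
            (regroup (sign c) (σ l (not c)) (χ (not c) u) (δ s u))
      where
      regroup : ∀ g a d e → g * (a * d * e) + 0ℤ ≡ g * a * d * e
      regroup = solve-∀

    twistedProduct-ft-cancels : ∀ l c (s u : Vec Bool l) →
      sign c * twistedProduct l false true (not c) s u + σ l (not c) * δ₀₁ s u * χ (not c) u ≡ 0ℤ
    twistedProduct-ft-cancels zero c [] [] = trans (+-identityʳ _) (*-zeroʳ (sign c))
    twistedProduct-ft-cancels (suc l) c s u =
      trans (cong₂ (λ x y → sign c * x + y * σ l (not (not c)) * δ₀₁ s u * χ (not c) u)
                   (twistedProduct-ft l (not c) s u) (sign-not c))
            (cancel (sign c) (σ l (not (not c))) (δ₀₁ s u) (χ (not c) u))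
      where
      cancel : ∀ g a p d → g * (a * p * d) + (- g) * a * p * d ≡ 0ℤ
      cancel = solve-∀

    twistedProduct-ft : ∀ l c (s u : Vec Bool (suc l)) →
      twistedProduct (suc l) false true c s u ≡ σ l (not c) * δ₀₁ s u * χ c u
    twistedProduct-ft l c (true ∷ s) (true ∷ u) =
      trans (cong₂ _+_ (sumℤ-zero l (λ t → refl)) (sumℤ-*0 l (transferℤ false s) (χ (not c))))
            (0+0≡a*0*d (σ l (not c)) (χ c (true ∷ u)))
    twistedProduct-ft l c (true ∷ s) (false ∷ u) =
      trans (cong₂ _+_ (sumℤ-zero l (λ t → refl)) (sumℤ-*0 l (transferℤ false s) (χ (not c))))
            (0+0≡a*0*d (σ l (not c)) (χ c (false ∷ u)))
    twistedProduct-ft l c (false ∷ s) (true ∷ u) =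
      trans (cong₂ _+_ (trans (twistedProduct-*ˡ l false false (not c) s u (sign c)) (cong (sign c *_) (twistedProduct-ff l (not c) s u)))
                       (sumℤ-*0 l (transferℤ true s) (χ (not c))))
            (regroup (sign c) (σ l (not c)) (χ (not c) u) (δ s u))
      where
      regroup : ∀ g a d e → g * (a * d * e) + 0ℤ ≡ a * e * (g * d)
      regroup = solve-∀
    twistedProduct-ft l c (false ∷ s) (false ∷ u) =
      trans (cong₂ _+_ (sumℤ-zero l (λ t → *-zeroʳ (transferℤ false s t * (sign c * χ (not c) t))))
                       (sumℤ-*0 l (transferℤ true s) (χ (not c))))
            (0+0≡a*0*d (σ l (not c)) (χ c (false ∷ u)))

    twistedProduct-tf : ∀ l c (s u : Vec Bool l) → twistedProduct l true false c s u ≡ σ l c * δ₀₁ s u * χ c u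
    twistedProduct-tf zero c [] [] = refl
    twistedProduct-tf (suc l) c (false ∷ s) (true ∷ u) =
      trans (cong₂ _+_ (sumℤ-zero l (λ t → refl)) (twistedProduct-ff l (not c) s u))
        (trans (+-identityˡ _) (trans (*-cancel-sq (sign c) _ (sign-sq c)) (regroup (sign c) (σ l (not c)) (χ (not c) u) (δ s u))))
      where
      regroup : ∀ g a d e → g * g * (a * d * e) ≡ g * a * e * (g * d)
      regroup = solve-∀
    twistedProduct-tf (suc l) c (false ∷ s) (false ∷ u) =
      trans (cong₂ _+_ (sumℤ-zero l (λ t → refl)) (sumℤ-*0 l (transferℤ false s) (χ (not c))))
            (0+0≡a*0*d (σ (suc l) c) (χ c (false ∷ u)))
    twistedProduct-tf (suc l) c (true ∷ s) (u₀ ∷ u) =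
      trans (cong₂ _+_ (sumℤ-zero l (λ t → refl)) (sumℤ-zero l (λ t → refl)))
            (0+0≡a*0*d (σ (suc l) c) (χ c (u₀ ∷ u)))

module TransferOrbit (m : ℕ) (c : Bool) where

  open import Data.Bool using (true; false; not)
  open import Data.Integer using (ℤ; +_; -[1+_]; _+_; _*_; _^_; 0ℤ; 1ℤ)
  open import Data.Integer.Properties using (+-identityʳ; +-assoc; *-comm; *-assoc; *-zeroʳ; *-identityˡ)
  open import Data.Integer.Tactic.RingSolver using (solve-∀)
  open import Data.List using (List; []; _∷_; length)
  open import Data.Nat as ℕ using (zero; suc)
  import Data.Nat.Properties as ℕₚ
  open import Data.Product using (_,_)
  open import Data.Vec using (Vec; []; _∷_; replicate)
  open import Relation.Binary.PropositionalEquality using (_≡_; refl; sym; trans; cong; cong₂; subst; module ≡-Reasoning)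
  open IntegerSums
  open LinearDependence {Vec Bool m}
  open Recurrences
  open TransferInverse

  RowVector : Set
  RowVector = Vec Bool m → ℤ

  Matrix : Set
  Matrix = Vec Bool m → Vec Bool m → ℤ

  A : Matrix
  A = transferℤ false

  B : Matrix
  B s t = σ m c * χ c s * χ c t * A (complement s) (complement t)

  infixl 7 _⋆_
  _⋆_ : RowVector → Matrix → RowVector
  (x ⋆ M) t = sumℤ m (λ s → x s * M s t)

  dot : RowVector → RowVector → ℤ
  dot x y = sumℤ m (λ s → x s * y s)

  allFalse : Vec Bool m
  allFalse = replicate m false

  e₀ : RowVector
  e₀ s = δ s allFalse

  forward : ℕ → RowVector
  forward zero    = e₀
  forward (suc k) = forward k ⋆ A

  backward : ℕ → RowVector
  backward zero    = e₀
  backward (suc k) = backward k ⋆ B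

  orbit : ℤ → RowVector
  orbit (+ k)    = forward k
  orbit -[1+ k ] = backward (suc k)

  transferSeq : ℤ → ℤ
  transferSeq n = orbit n allFalse

  A-sym : ∀ s t → A s t ≡ A t s
  A-sym s t = cong +_ (transfer-sym false s t)

  B-sym : ∀ s t → B s t ≡ B t s
  B-sym s t = trans (cong (σ m c * χ c s * χ c t *_) (A-sym (complement s) (complement t)))
                    (swap (σ m c) (χ c s) (χ c t) (A (complement t) (complement s)))
    where
    swap : ∀ a x y z → a * x * y * z ≡ a * y * x * z
    swap = solve-∀

  A⋆B : ∀ s u → sumℤ m (λ t → A s t * B t u) ≡ δ s u
  A⋆B s u = begin
      sumℤ m (λ t → A s t * B t u)
    ≡⟨ sumℤ-cong m (λ t → regroup (A s t) (σ m c) (χ c t) (χ c u) (A (complement t) (complement u))) ⟩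
      sumℤ m (λ t → (σ m c * χ c u) * (A s t * χ c t * A (complement t) (complement u)))
    ≡⟨ sumℤ-*ˡ m (σ m c * χ c u) (λ t → A s t * χ c t * A (complement t) (complement u)) ⟩
      (σ m c * χ c u) * twistedProduct m false false c s u
    ≡⟨ cong ((σ m c * χ c u) *_) (twistedProduct-ff m c s u) ⟩
      (σ m c * χ c u) * (σ m c * χ c u * δ s u)
    ≡⟨ square (σ m c) (χ c u) (δ s u) ⟩
      (σ m c * σ m c) * (χ c u * χ c u) * δ s u
    ≡⟨ cong₂ (λ a b → a * b * δ s u) (σ-sq m c) (χ-sq c u) ⟩
      1ℤ * 1ℤ * δ s u
    ≡⟨ one (δ s u) ⟩
      δ s u
    ∎
    where
    open ≡-Reasoning
    regroup : ∀ a g x y b → a * (g * x * y * b) ≡ (g * y) * (a * x * b)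
    regroup = solve-∀
    square : ∀ g y d → (g * y) * (g * y * d) ≡ (g * g) * (y * y) * d
    square = solve-∀
    one : ∀ d → 1ℤ * 1ℤ * d ≡ d
    one = solve-∀

  B⋆A : ∀ s u → sumℤ m (λ t → B s t * A t u) ≡ δ s u
  B⋆A s u = trans (sumℤ-cong m (λ t → trans (cong₂ _*_ (B-sym s t) (A-sym t u)) (*-comm (B t s) (A u t))))
                  (trans (A⋆B u s) (δ-sym u s))

  ⋆-cong : ∀ {x y} M → (∀ s → x s ≡ y s) → ∀ t → (x ⋆ M) t ≡ (y ⋆ M) t
  ⋆-cong M x≗y t = sumℤ-cong m (λ s → cong (_* M s t) (x≗y s))

  dot-cong : ∀ {x y} z → (∀ s → x s ≡ y s) → dot x z ≡ dot y z
  dot-cong z x≗y = sumℤ-cong m (λ s → cong (_* z s) (x≗y s))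

  ⋆-⋆ : ∀ x M N t → (x ⋆ M ⋆ N) t ≡ sumℤ m (λ r → x r * sumℤ m (λ s → M r s * N s t))
  ⋆-⋆ x M N t = begin
      sumℤ m (λ s → sumℤ m (λ r → x r * M r s) * N s t)
    ≡⟨ sumℤ-cong m (λ s → sym (sumℤ-*ʳ m (λ r → x r * M r s) (N s t))) ⟩
      sumℤ m (λ s → sumℤ m (λ r → x r * M r s * N s t))
    ≡⟨ sumℤ-swap m m (λ s r → x r * M r s * N s t) ⟩
      sumℤ m (λ r → sumℤ m (λ s → x r * M r s * N s t))
    ≡⟨ sumℤ-cong m (λ r → trans (sumℤ-cong m (λ s → *-assoc′ (x r) (M r s) (N s t))) (sumℤ-*ˡ m (x r) _)) ⟩
      sumℤ m (λ r → x r * sumℤ m (λ s → M r s * N s t))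
    ∎
    where
    open ≡-Reasoning
    *-assoc′ : ∀ a b d → a * b * d ≡ a * (b * d)
    *-assoc′ = solve-∀

  ⋆B⋆A : ∀ x t → (x ⋆ B ⋆ A) t ≡ x t
  ⋆B⋆A x t = trans (⋆-⋆ x B A t) (trans (sumℤ-cong m (λ r → cong (x r *_) (B⋆A r t))) (sumℤ-δ m x t))

  dot-⋆A : ∀ x y → dot (x ⋆ A) y ≡ dot x (y ⋆ A)
  dot-⋆A x y = begin
      sumℤ m (λ t → sumℤ m (λ s → x s * A s t) * y t)
    ≡⟨ sumℤ-cong m (λ t → sym (sumℤ-*ʳ m (λ s → x s * A s t) (y t))) ⟩
      sumℤ m (λ t → sumℤ m (λ s → x s * A s t * y t))
    ≡⟨ sumℤ-swap m m (λ t s → x s * A s t * y t) ⟩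
      sumℤ m (λ s → sumℤ m (λ t → x s * A s t * y t))
    ≡⟨ sumℤ-cong m (λ s → trans (sumℤ-cong m (λ t → trans (cong (λ a → x s * a * y t) (A-sym s t)) (regroup (x s) (A t s) (y t))))
                                (sumℤ-*ˡ m (x s) _)) ⟩
      sumℤ m (λ s → x s * sumℤ m (λ t → y t * A t s))
    ∎
    where
    open ≡-Reasoning
    regroup : ∀ a b d → a * b * d ≡ a * (d * b)
    regroup = solve-∀

  orbit-suc : ∀ n t → orbit (n + 1ℤ) t ≡ (orbit n ⋆ A) t
  orbit-suc (+ k)          t = cong (λ j → forward j t) (ℕₚ.+-comm k 1)
  orbit-suc -[1+ zero ]    t = sym (⋆B⋆A e₀ t)
  orbit-suc -[1+ suc k ]   t = sym (⋆B⋆A (backward (suc k)) t)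

  transferSeq-+ : ∀ j n → transferSeq (n + + j) ≡ dot (orbit n) (forward j)
  transferSeq-+ zero    n = trans (cong transferSeq (+-identityʳ n)) (sym (sumℤ-δ m (orbit n) allFalse))
  transferSeq-+ (suc j) n = begin
      transferSeq (n + + suc j)
    ≡⟨ cong transferSeq (sym (+-assoc n 1ℤ (+ j))) ⟩
      transferSeq (n + 1ℤ + + j)
    ≡⟨ transferSeq-+ j (n + 1ℤ) ⟩
      dot (orbit (n + 1ℤ)) (forward j)
    ≡⟨ dot-cong (forward j) (orbit-suc n) ⟩
      dot (orbit n ⋆ A) (forward j)
    ≡⟨ dot-⋆A (orbit n) (forward j) ⟩
      dot (orbit n) (forward (suc j))
    ∎
    where open ≡-Reasoning

  combine : List ℤ → ℕ → RowVector
  combine []       j s = 0ℤ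
  combine (a ∷ cs) j s = a * forward j s + combine cs (suc j) s

  dot-*+ : ∀ x a y z → dot x (λ s → a * y s + z s) ≡ a * dot x y + dot x z
  dot-*+ x a y z =
    trans (sumℤ-cong m (λ s → distrib (x s) a (y s) (z s))) (trans (sumℤ-+ m _ _) (cong (_+ dot x z) (sumℤ-*ˡ m a _)))
    where
    distrib : ∀ p a q r → p * (a * q + r) ≡ a * (p * q) + p * r
    distrib = solve-∀

  recSum-transferSeq : ∀ cs j n → recSum cs transferSeq (n + + j) ≡ dot (orbit n) (combine cs j)
  recSum-transferSeq []       j n = sym (sumℤ-zero m (λ s → *-zeroʳ (orbit n s)))
  recSum-transferSeq (a ∷ cs) j n = begin
      a * transferSeq (n + + j) + recSum cs transferSeq (n + + j + 1ℤ)
    ≡⟨ cong₂ (λ u v → a * u + v) (transferSeq-+ j n)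
             (cong (recSum cs transferSeq) (trans (+-assoc n (+ j) 1ℤ) (cong (λ i → n + + i) (ℕₚ.+-comm j 1)))) ⟩
      a * dot (orbit n) (forward j) + recSum cs transferSeq (n + + suc j)
    ≡⟨ cong (λ x → a * dot (orbit n) (forward j) + x) (recSum-transferSeq cs (suc j) n) ⟩
      a * dot (orbit n) (forward j) + dot (orbit n) (combine cs (suc j))
    ≡⟨ dot-*+ (orbit n) a (forward j) (combine cs (suc j)) ⟨
      dot (orbit n) (combine (a ∷ cs) j)
    ∎
    where open ≡-Reasoning

  forwards : ℕ → ℕ → List RowVector
  forwards j zero    = []
  forwards j (suc k) = forward j ∷ forwards (suc j) k

  length-forwards : ∀ j k → length (forwards j k) ≡ k
  length-forwards j zero    = refl
  length-forwards j (suc k) = cong suc (length-forwards (suc j) k)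

  lincomb-forwards : ∀ cs j k s → length cs ≡ k → lincomb cs (forwards j k) s ≡ combine cs j s
  lincomb-forwards []       j k       s _    = refl
  lincomb-forwards (a ∷ cs) j (suc k) s |cs| =
    cong (λ x → a * forward j s + x) (lincomb-forwards cs (suc j) k s (ℕₚ.suc-injective |cs|))

  -- A vanishing combination of more powers e₀ Aʲ than there are states is a recurrence.
  transferSeq-recurrent : SatisfiesLinRec transferSeq
  transferSeq-recurrent
    with vanishingCombination (allVecs m) (forwards 0 (suc (length (allVecs m))))
                              (subst (length (allVecs m) ℕ.<_) (sym (length-forwards 0 _)) ℕₚ.≤-refl)
  ... | cs , |cs| , nonzero , vanishes = cs , nonzero , recurrence
    where
    combine≡0 : ∀ s → combine cs 0 s ≡ 0ℤ
    combine≡0 s = trans (sym (lincomb-forwards cs 0 _ s (trans |cs| (length-forwards 0 _)))) (vanishes s (∈-allVecs s))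
    recurrence : ∀ n → recSum cs transferSeq n ≡ 0ℤ
    recurrence n = trans (cong (recSum cs transferSeq) (sym (+-identityʳ n)))
      (trans (recSum-transferSeq cs 0 n)
             (trans (sumℤ-cong m (λ s → cong (orbit n s *_) (combine≡0 s))) (sumℤ-zero m (λ s → *-zeroʳ (orbit n s)))))

  allTrue : Vec Bool m
  allTrue = replicate m true

  twist : RowVector → RowVector
  twist x s = χ c s * x (complement s)

  ⋆-*ˡ : ∀ k x M t → ((λ s → k * x s) ⋆ M) t ≡ k * (x ⋆ M) t
  ⋆-*ˡ k x M t = trans (sumℤ-cong m (λ s → *-assoc k (x s) (M s t))) (sumℤ-*ˡ m k _)

  twist⋆B : ∀ x t → (twist x ⋆ B) t ≡ σ m c * twist (x ⋆ A) t
  twist⋆B x t = begin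
      sumℤ m (λ s → χ c s * x (complement s) * (σ m c * χ c s * χ c t * A (complement s) (complement t)))
    ≡⟨ sumℤ-cong m (λ s → trans (regroup (χ c s) (x (complement s)) (σ m c) (χ c t) (A (complement s) (complement t)))
                                (cong (λ z → σ m c * χ c t * (z * (x (complement s) * A (complement s) (complement t)))) (χ-sq c s))) ⟩
      sumℤ m (λ s → σ m c * χ c t * (1ℤ * (x (complement s) * A (complement s) (complement t))))
    ≡⟨ sumℤ-*ˡ m (σ m c * χ c t) _ ⟩
      σ m c * χ c t * sumℤ m (λ s → 1ℤ * (x (complement s) * A (complement s) (complement t)))
    ≡⟨ cong (σ m c * χ c t *_) (trans (sumℤ-cong m (λ s → *-identityˡ _)) (sumℤ-complement m (λ s → x s * A s (complement t)))) ⟩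
      σ m c * χ c t * (x ⋆ A) (complement t)
    ≡⟨ *-assoc (σ m c) (χ c t) _ ⟩
      σ m c * twist (x ⋆ A) t
    ∎
    where
    open ≡-Reasoning
    regroup : ∀ d x g e a → d * x * (g * d * e * a) ≡ g * e * (d * d * (x * a))
    regroup = solve-∀

  fromAllTrue : ℕ → RowVector
  fromAllTrue zero    s = δ s allTrue
  fromAllTrue (suc k) = fromAllTrue k ⋆ A

  χ-δ-complement : ∀ {l} c′ (t : Vec Bool l) → χ c′ t * δ (complement t) (replicate l true) ≡ δ t (replicate l false)
  χ-δ-complement c′ []          = refl
  χ-δ-complement c′ (true ∷ t)  = *-zeroʳ (sign c′ * χ (not c′) t)
  χ-δ-complement c′ (false ∷ t) = χ-δ-complement (not c′) t

  backward≡twist : ∀ k t → backward k t ≡ σ m c ^ k * twist (fromAllTrue k) t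
  backward≡twist zero    t = sym (trans (*-identityˡ _) (χ-δ-complement c t))
  backward≡twist (suc k) t = begin
      (backward k ⋆ B) t
    ≡⟨ ⋆-cong B (backward≡twist k) t ⟩
      ((λ s → σ m c ^ k * twist (fromAllTrue k) s) ⋆ B) t
    ≡⟨ ⋆-*ˡ (σ m c ^ k) (twist (fromAllTrue k)) B t ⟩
      σ m c ^ k * (twist (fromAllTrue k) ⋆ B) t
    ≡⟨ cong (σ m c ^ k *_) (twist⋆B (fromAllTrue k) t) ⟩
      σ m c ^ k * (σ m c * twist (fromAllTrue (suc k)) t)
    ≡⟨ regroup (σ m c ^ k) (σ m c) _ ⟩
      σ m c ^ suc k * twist (fromAllTrue (suc k)) t
    ∎
    where
    open ≡-Reasoning
    regroup : ∀ p s x → p * (s * x) ≡ s * p * x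
    regroup = solve-∀

  χ-allFalse : ∀ {l} c′ → χ c′ (replicate l false) ≡ 1ℤ
  χ-allFalse {zero}  c′ = refl
  χ-allFalse {suc l} c′ = χ-allFalse {l} (not c′)

  complement-allFalse : ∀ {l} → complement (replicate l false) ≡ replicate l true
  complement-allFalse {zero}  = refl
  complement-allFalse {suc l} = cong (true ∷_) (complement-allFalse {l})

  transfer-allTrue : ∀ {l} (t : Vec Bool l) → transferℤ false (replicate l true) t ≡ δ t (replicate l false)
  transfer-allTrue []          = refl
  transfer-allTrue (true ∷ t)  = refl
  transfer-allTrue (false ∷ t) = transfer-allTrue t

  fromAllTrue-suc : ∀ k t → fromAllTrue (suc k) t ≡ forward k t
  fromAllTrue-suc zero    t =
    trans (sumℤ-cong m (λ s → *-comm (δ s allTrue) (A s t))) (trans (sumℤ-δ m (λ s → A s t) allTrue) (transfer-allTrue t))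
  fromAllTrue-suc (suc k) t = ⋆-cong A (fromAllTrue-suc k) t

  forward-allTrue : ∀ k → forward (suc k) allTrue ≡ forward k allFalse
  forward-allTrue k =
    trans (sumℤ-cong m (λ s → cong (forward k s *_) (trans (A-sym s allTrue) (transfer-allTrue s)))) (sumℤ-δ m (forward k) allFalse)

  backward-allFalse : ∀ k → backward k allFalse ≡ σ m c ^ k * fromAllTrue k allTrue
  backward-allFalse k = trans (backward≡twist k allFalse) (cong (σ m c ^ k *_)
    (trans (cong₂ _*_ (χ-allFalse {m} c) (cong (fromAllTrue k) (complement-allFalse {m}))) (*-identityˡ (fromAllTrue k allTrue))))

  transferSeq-reciprocity : ∀ k → transferSeq -[1+ suc k ] ≡ σ m c ^ k * transferSeq (+ k)
  transferSeq-reciprocity k = begin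
      backward (suc (suc k)) allFalse
    ≡⟨ backward-allFalse (suc (suc k)) ⟩
      σ m c * (σ m c * σ m c ^ k) * fromAllTrue (suc (suc k)) allTrue
    ≡⟨ cong (σ m c * (σ m c * σ m c ^ k) *_) (trans (fromAllTrue-suc (suc k) allTrue) (forward-allTrue k)) ⟩
      σ m c * (σ m c * σ m c ^ k) * forward k allFalse
    ≡⟨ regroup (σ m c) (σ m c ^ k) (forward k allFalse) ⟩
      σ m c * σ m c * (σ m c ^ k * forward k allFalse)
    ≡⟨ cong (_* (σ m c ^ k * forward k allFalse)) (σ-sq m c) ⟩
      1ℤ * (σ m c ^ k * forward k allFalse)
    ≡⟨ *-identityˡ _ ⟩
      σ m c ^ k * forward k allFalse
    ∎
    where
    open ≡-Reasoning
    regroup : ∀ s p x → s * (s * p) * x ≡ s * s * (p * x)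
    regroup = solve-∀

module Sign where

  open TransferInverse using (σ)
  open import Data.Bool using (true; false; if_then_else_; _∧_)
  open import Data.Integer using (+_; -[1+_]; _*_; _^_; 1ℤ; -1ℤ; ∣_∣)
  open import Data.Integer.Properties using (*-identityˡ; *-assoc)
  open import Data.Integer.Tactic.RingSolver using (solve-∀)
  open import Data.Nat using (zero; suc; _%_; _≡ᵇ_)
  open import Data.Nat.DivMod using ([m+n]%n≡m%n)
  import Data.Nat.Properties as ℕₚ
  open import Relation.Binary.PropositionalEquality using (_≡_; refl; sym; trans; cong)

  %4-period : ∀ m → suc (suc (suc (suc m))) % 4 ≡ m % 4
  %4-period m = trans (cong (_% 4) (ℕₚ.+-comm 4 m)) ([m+n]%n≡m%n m 4)

  %2-period : ∀ m → suc (suc m) % 2 ≡ m % 2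
  %2-period m = trans (cong (_% 2) (ℕₚ.+-comm 2 m)) ([m+n]%n≡m%n m 2)

  σ-period : ∀ m c → σ (suc (suc (suc (suc m)))) c ≡ σ m c
  σ-period m false = alternate (σ m false)
    where
    alternate : ∀ x → 1ℤ * (-1ℤ * (1ℤ * (-1ℤ * x))) ≡ x
    alternate = solve-∀
  σ-period m true = alternate (σ m true)
    where
    alternate : ∀ x → -1ℤ * (1ℤ * (-1ℤ * (1ℤ * x))) ≡ x
    alternate = solve-∀

  σ-mod4 : ∀ m → σ m (m % 4 ≡ᵇ 3) ≡ (if m % 4 ≡ᵇ 2 then -1ℤ else 1ℤ)
  σ-mod4 zero                      = refl
  σ-mod4 (suc zero)                = refl
  σ-mod4 (suc (suc zero))          = refl
  σ-mod4 (suc (suc (suc zero)))    = refl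
  σ-mod4 (suc (suc (suc (suc m)))) rewrite %4-period m = trans (σ-period m (m % 4 ≡ᵇ 3)) (σ-mod4 m)

  ±1-^ : ∀ b k → (if b then -1ℤ else 1ℤ) ^ k ≡ (if b ∧ (k % 2 ≡ᵇ 1) then -1ℤ else 1ℤ)
  ±1-^ false zero          = refl
  ±1-^ true  zero          = refl
  ±1-^ false (suc zero)    = refl
  ±1-^ true  (suc zero)    = refl
  ±1-^ false (suc (suc k)) rewrite %2-period k = trans (*-identityˡ _) (trans (*-identityˡ _) (±1-^ false k))
  ±1-^ true  (suc (suc k)) rewrite %2-period k = trans (sym (*-assoc -1ℤ -1ℤ _)) (trans (*-identityˡ _) (±1-^ true k))

  σ^≡eps : ∀ m k → σ m (m % 4 ≡ᵇ 3) ^ k ≡ eps m (+ k)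
  σ^≡eps m k = trans (cong (_^ k) (σ-mod4 m)) (±1-^ (m % 4 ≡ᵇ 2) k)

  eps-sq : ∀ m n → eps m n * eps m n ≡ 1ℤ
  eps-sq m n with (m % 4 ≡ᵇ 2) ∧ (∣ n ∣ % 2 ≡ᵇ 1)
  ... | true  = refl
  ... | false = refl

  eps-neg : ∀ m j → eps m -[1+ suc j ] ≡ eps m (+ j)
  eps-neg m j = cong (λ r → if (m % 4 ≡ᵇ 2) ∧ (r ≡ᵇ 1) then -1ℤ else 1ℤ) (%2-period j)

module Tilings (l : ℕ) where

  open IntegerSums
  open ColumnDecomposition using (sumℕ)
  open TransferMatrix using (transfer; partialTilings; partialTilings-one; partialTilings-suc; tilingCount≡partialTilings)
  open Recurrences using (recurrent-unique)
  open Sign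
  open TransferInverse using (σ)
  open import Data.Bool using (false)
  open import Data.Integer using (+_; -[1+_]; _+_; _*_; _-_; 0ℤ; 1ℤ)
  open import Data.Integer.Properties using (*-comm; *-assoc; *-zeroʳ; *-identityˡ; pos-*)
  open import Data.Nat as ℕ using (zero; suc; _≤_; _%_; _≡ᵇ_; s≤s; z≤n)
  open import Data.Product using (_,_)
  open import Relation.Binary.PropositionalEquality using (_≡_; sym; trans; cong; cong₂; module ≡-Reasoning)

  -- For odd m the sign is irrelevant at odd n, where T(m, n) = 0; this choice makes σ equal to ε without using that.
  c : Bool
  c = suc l % 4 ≡ᵇ 3

  open TransferOrbit (suc l) c public

  partialTilings≡forward : ∀ k S → + partialTilings (suc l) (suc k) S ≡ forward (suc k) S
  partialTilings≡forward zero    S = trans (cong +_ (partialTilings-one l S))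
    (sym (trans (sumℤ-cong (suc l) (λ s → *-comm (δ s allFalse) (A s S))) (sumℤ-δ (suc l) (λ s → A s S) allFalse)))
  partialTilings≡forward (suc k) S = begin
      + partialTilings (suc l) (suc (suc k)) S
    ≡⟨ cong +_ (partialTilings-suc l k S) ⟩
      + sumℕ (suc l) (λ H → partialTilings (suc l) (suc k) H ℕ.* transfer false H S)
    ≡⟨ sumℕ-ℤ (suc l) (λ H → partialTilings (suc l) (suc k) H ℕ.* transfer false H S) ⟩
      sumℤ (suc l) (λ H → + (partialTilings (suc l) (suc k) H ℕ.* transfer false H S))
    ≡⟨ sumℤ-cong (suc l) (λ H → trans (pos-* (partialTilings (suc l) (suc k) H) (transfer false H S))
                                      (cong (_* A H S) (partialTilings≡forward k H))) ⟩
      forward (suc (suc k)) S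
    ∎
    where open ≡-Reasoning

  transferSeq≡tilingCount : ∀ k → transferSeq (+ suc k) ≡ + tilingCount (suc l) (suc k)
  transferSeq≡tilingCount k =
    sym (trans (cong +_ (tilingCount≡partialTilings l k)) (partialTilings≡forward k allFalse))

  transferSeq-extrapolates : ∀ f → SatisfiesLinRec f → ((n : ℕ) → 1 ≤ n → f (+ n) ≡ + tilingCount (suc l) n) →
    ∀ n → f n ≡ transferSeq n
  transferSeq-extrapolates f (ps , ps≢0 , rec-f) tiles with transferSeq-recurrent
  ... | cs , cs≢0 , rec = recurrent-unique f transferSeq ps cs ps≢0 cs≢0 rec-f rec
    (λ i → trans (tiles (suc i) (s≤s z≤n)) (sym (transferSeq≡tilingCount i)))

  transferSeq-minus1 : transferSeq -[1+ 0 ] ≡ 0ℤ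
  transferSeq-minus1 =
    trans (backward-allFalse 1) (trans (cong (σ (suc l) c * 1ℤ *_) (fromAllTrue-suc 0 allTrue)) (*-zeroʳ (σ (suc l) c * 1ℤ)))

  -- (+ 0 - + 2) - n computes to -[1+ suc k ] for n = + k, and to + j for n = -[1+ suc j ].
  transferSeq-reflection : ∀ n → transferSeq ((+ 0 - + 2) - n) ≡ eps (suc l) n * transferSeq n
  transferSeq-reflection (+ zero)     = trans (transferSeq-reciprocity 0) (cong (_* transferSeq (+ 0)) (σ^≡eps (suc l) 0))
  transferSeq-reflection (+ suc k)    =
    trans (transferSeq-reciprocity (suc k)) (cong (_* transferSeq (+ suc k)) (σ^≡eps (suc l) (suc k)))
  transferSeq-reflection -[1+ zero ]  = trans transferSeq-minus1
    (sym (trans (cong (eps (suc l) -[1+ 0 ] *_) transferSeq-minus1) (*-zeroʳ (eps (suc l) -[1+ 0 ]))))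
  transferSeq-reflection -[1+ suc j ] = sym (begin
      eps (suc l) -[1+ suc j ] * transferSeq -[1+ suc j ]
    ≡⟨ cong₂ _*_ (eps-neg (suc l) j) (trans (transferSeq-reciprocity j) (cong (_* transferSeq (+ j)) (σ^≡eps (suc l) j))) ⟩
      ε * (ε * transferSeq (+ j))
    ≡⟨ *-assoc ε ε _ ⟨
      ε * ε * transferSeq (+ j)
    ≡⟨ cong (_* transferSeq (+ j)) (eps-sq (suc l) (+ j)) ⟩
      1ℤ * transferSeq (+ j)
    ≡⟨ *-identityˡ _ ⟩
      transferSeq (+ j)
    ∎)
    where
    open ≡-Reasoning
    ε = eps (suc l) (+ j)

open import Data.Integer using (ℤ; +_; _-_; _*_)
open import Data.Nat using (suc; _≤_)
open import Relation.Binary.PropositionalEquality using (_≡_; cong; module ≡-Reasoning)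

mainTheorem1 : (m : ℕ) → 1 ≤ m → (f : ℤ → ℤ) → SatisfiesLinRec f
    → ((n : ℕ) → 1 ≤ n → f (+ n) ≡ + tilingCount m n)
    → (n : ℤ) → f ((+ 0 - + 2) - n) ≡ eps m n * f n
mainTheorem1 (suc l) _ f f-recurrent tiles n = begin
    f ((+ 0 - + 2) - n)
  ≡⟨ f≡transferSeq _ ⟩
    transferSeq ((+ 0 - + 2) - n)
  ≡⟨ transferSeq-reflection n ⟩
    eps (suc l) n * transferSeq n
  ≡⟨ cong (eps (suc l) n *_) (f≡transferSeq n) ⟨
    eps (suc l) n * f n
  ∎
  where
  open ≡-Reasoning
  open Tilings l
  f≡transferSeq : ∀ n → f n ≡ transferSeq n
  f≡transferSeq = transferSeq-extrapolates f f-recurrent tiles
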